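{- Let $J=(\{1,\ldots,n\},\preceq_J)$ be a finite poset and let $J_p=\{p,s_1,\ldots,s_r\}\subseteq J$ ($r\ge1$) be an inward or outward $p$-anchored path of $J$. Then $J$ and $\delta_{J_p}J$ are strongly Gram $\mathbb{Z}$-congruent, i.e. $C_{J}=B^{tr}C_{\delta_{J_p}J}B$ for some $B\in M_n(\mathbb{Z})$ with $\det B=\pm1$. In particular, $J$ is non-negative of corank $r'\ge0$ if and only if $\delta_{J_p}J$ is non-negative of corank $r'$.
   Context: For a finite poset $I$ on $\{1,\ldots,n\}$: incidence matrix $C_I=[c_{ij}]$ with $c_{ij}=1$ iff $i\preceq_I j$, else $0$; $G_I=\tfrac12(C_I+C_I^{tr})$; $I$ is non-negative of corank $r'$ if $G_I$ is positive semi-definite of rank $n-r'$. The Hasse digraph $\mathcal{H}(I)$ has an arrow $i\to j$ iff $i\prec_I j$ and no $k$ lies strictly between. For an acyclic digraph $D$ on $\{1,\ldots,n\}$, $I_D$ is the poset with $a\preceq b$ iff there is a directed path from $a$ to $b$ in $D$ (including $a=b$). A subposet $J_p=\{p,s_1,\ldots,s_r\}$ of $J$ is a $p$-anchored path if the underlying graph of $\mathcal{H}(J)$ contains the edges $p - s_1 - s_2 - \cdots - s_r$ and the vertices $s_1,\ldots,s_r$ have no other neighbours in $\mathcal{H}(J)$ (so $\mathcal{H}(J)\setminus\{p\}$ is disconnected, $\mathcal{H}(J_p)$ has a path as underlying graph and $p$ has degree one in it). It is inward if $p$ is the unique maximal element of $J_p$ (arrows $s_r\to\cdots\to s_1\to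 p$) and outward if $p$ is the unique minimal element of $J_p$ (arrows $p\to s_1\to\cdots\to s_r$). The $J_p$-reflection $\delta_{J_p}J$ is the poset $I_D$, where $D$ is obtained from $\mathcal{H}(J)$ by reversing all arrows between vertices of $J_p$. -}

module Defs where

open import Data.Nat as ℕ using (ℕ; zero; suc)
open import Data.Fin using (Fin; zero; suc; toℕ; punchIn)
open import Data.Integer as ℤ using (ℤ; +_; -_; _+_; _*_)
open import Data.Bool using (if_then_else_)
open import Data.Product using (Σ; Σ-syntax; ∃; _×_)
open import Data.Sum using (_⊎_)
open import Relation.Nullary using (¬_; does)
open import Relation.Binary.PropositionalEquality using (_≡_; _≢_)
open import Relation.Binary.Definitions using (Decidable)
open import Relation.Binary.Structures using (IsPartialOrder)
open import Relation.Binary.Construct.Closure.ReflexiveTransitive using (Star)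
open import Function.Definitions using (Injective)

Matrix : ℕ → Set
Matrix n = Fin n → Fin n → ℤ

∑ : ∀ {n} → (Fin n → ℤ) → ℤ
∑ {zero}  f = + 0
∑ {suc n} f = f zero + ∑ (λ i → f (suc i))

_ᵀ : ∀ {n} → Matrix n → Matrix n
(M ᵀ) i j = M j i

_⊗_ : ∀ {n} → Matrix n → Matrix n → Matrix n
(A ⊗ B) i j = ∑ (λ k → A i k * B k j)

_⊕_ : ∀ {n} → Matrix n → Matrix n → Matrix n
(A ⊕ B) i j = A i j + B i j

_≐_ : ∀ {n} → Matrix n → Matrix n → Set
A ≐ B = ∀ i j → A i j ≡ B i j

sgn : ℕ → ℤ
sgn zero    = + 1
sgn (suc k) = - sgn k

det : ∀ {n} → Matrix n → ℤ
det {zero}  M = + 1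
det {suc n} M =
  ∑ (λ j → sgn (toℕ j) * M zero j * det (λ a b → M (suc a) (punchIn j b)))

minor : ∀ {n k} → Matrix n → (Fin k → Fin n) → (Fin k → Fin n) → Matrix k
minor M f g a b = M (f a) (g b)

HasRank : ∀ {n} → Matrix n → ℕ → Set
HasRank {n} M k =
  (Σ[ f ∈ (Fin k → Fin n) ] Σ[ g ∈ (Fin k → Fin n) ]
     Injective _≡_ _≡_ f × Injective _≡_ _≡_ g × det (minor M f g) ≢ + 0)
  × (∀ l → k ℕ.< l → (f g : Fin l → Fin n) →
       Injective _≡_ _≡_ f → Injective _≡_ _≡_ g → det (minor M f g) ≡ + 0)

PSD : ∀ {n} → Matrix n → Set
PSD {n} M = ∀ (x : Fin n → ℤ) → + 0 ℤ.≤ ∑ (λ i → ∑ (λ j → x i * M i j * x j))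

-- C is non-negative of corank r': G = ½(C + Cᵀ) is PSD of rank n - r'.
-- We use 2G = C + Cᵀ (same PSD-ness and rank, integral entries).
NonNegCorank : ∀ {n} → Matrix n → ℕ → Set
NonNegCorank {n} C r' =
  r' ℕ.≤ n × PSD (C ⊕ (C ᵀ)) × HasRank (C ⊕ (C ᵀ)) (n ℕ.∸ r')

record FinPoset (n : ℕ) : Set₁ where
  field
    _≼_            : Fin n → Fin n → Set
    isPartialOrder : IsPartialOrder _≡_ _≼_
    _≼?_           : Decidable _≼_

  _≺_ : Fin n → Fin n → Set
  i ≺ j = i ≼ j × i ≢ j

  Cov : Fin n → Fin n → Set
  Cov i j = i ≺ j × (∀ k → ¬ (i ≺ k × k ≺ j))

  Adj : Fin n → Fin n → Set
  Adj i j = Cov i j ⊎ Cov j i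

incidence : ∀ {n} → FinPoset n → Matrix n
incidence J i j = if does (i ≼? j) then + 1 else + 0
  where open FinPoset J

IsIncidenceOf : ∀ {n} → (Fin n → Fin n → Set) → Matrix n → Set
IsIncidenceOf R M = ∀ i j → (R i j → M i j ≡ + 1) × (¬ R i j → M i j ≡ + 0)

-- p-anchored paths J_p = {p, s_1, ..., s_r}; s_{k+1} is  s k  (k : Fin r)

module _ {n : ℕ} (J : FinPoset n) (p : Fin n) {r : ℕ} (s : Fin r → Fin n) where
  open FinPoset J

  PathPred : Fin r → Fin n → Set
  PathPred i v = (toℕ i ≡ 0 × v ≡ p) ⊎ (Σ[ k ∈ Fin r ] (suc (toℕ k) ≡ toℕ i × v ≡ s k))

  PathSucc : Fin r → Fin n → Set
  PathSucc i v = Σ[ k ∈ Fin r ] (toℕ k ≡ suc (toℕ i) × v ≡ s k)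

  InJp : Fin n → Set
  InJp v = v ≡ p ⊎ ∃ (λ i → s i ≡ v)

  record AnchoredPath : Set where
    field
      distinct  : Injective _≡_ _≡_ s
      notAnchor : ∀ i → s i ≢ p
      neighbours : ∀ i v → (Adj v (s i) → PathPred i v ⊎ PathSucc i v)
                         × (PathPred i v ⊎ PathSucc i v → Adj v (s i))

  Inward : Set
  Inward = ∀ i v → PathPred i v → Cov (s i) v

  Outward : Set
  Outward = ∀ i v → PathPred i v → Cov v (s i)

  ReflEdge : Fin n → Fin n → Set
  ReflEdge a b = (Cov a b × ¬ (InJp a × InJp b)) ⊎ (Cov b a × InJp a × InJp b)

  _≼δ_ : Fin n → Fin n → Set
  _≼δ_ = Star ReflEdge

-- Let B fix e_v for v off the path and send e_{s_i} to e_p − e_{s_{r+1−i}}.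
-- Then B² = 1, so det B = ±1, and C_J = Bᵀ C_δ B follows by comparing the two
-- reachability relations entry by entry (the inward case is the outward case
-- for δJ): off the path the orders agree; an off-path vertex lies below s_i in
-- J iff it lies below p, and below no s_i in δJ; nothing off the path lies above
-- an s_i in J, while in δJ lying above s_i means lying above p; along the path
-- the order is reversed, matching the index reversal i ↦ r+1−i in B.
-- Congruence by an integral matrix with integral inverse preserves positive
-- semi-definiteness of C + Cᵀ and, by expanding minors of Bᵀ (C + Cᵀ) B by
-- multilinearity, its rank; hence it preserves the corank.

module Submission where

open import Defs
open import Data.Nat using (ℕ; _≤_)
open import Data.Fin using (Fin)
open import Data.Integer using (+_; -_)
open import Data.Product using (Σ-syntax; _×_)
open import Data.Sum using (_⊎_)
open import Relation.Binary.PropositionalEquality using (_≡_)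
open import Function.Bundles using (_⇔_; mk⇔)

open import Data.Nat as ℕ using (zero; suc; z≤n; s≤s)
import Data.Nat.Properties as ℕP
open import Data.Fin using (zero; suc; toℕ; punchIn; punchOut; inject₁; fromℕ<; opposite; _≟_)
import Data.Fin.Properties as FinP
open import Data.Fin.Permutation.Components using (transpose; transpose-inverse)
open import Data.Vec.Functional using (_∷_)
open import Data.Integer as ℤ using (ℤ; _+_; _*_; _-_; ∣_∣; -[1+_])
import Data.Integer.Properties as ℤP
open import Data.Integer.Tactic.RingSolver using (solve-∀)
open import Data.Product using (Σ; ∃; _,_; proj₁; proj₂)
open import Data.Sum using (inj₁; inj₂)
open import Data.Empty using (⊥; ⊥-elim)
open import Function using (_∘_; id)
open import Function.Definitions using (Injective)
open import Relation.Binary.Definitions using (tri<; tri≈; tri>)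
open import Relation.Binary.Structures using (IsPartialOrder)
open import Relation.Binary.Construct.Closure.ReflexiveTransitive as Star
  using (Star; ε; _◅_; _◅◅_; reverse)
open import Relation.Nullary using (¬_; Dec; yes; no)
open import Relation.Nullary.Decidable using (dec-true; dec-false; _×-dec_; ¬?; map′)
open import Relation.Binary.PropositionalEquality
  using (_≢_; refl; sym; trans; cong; cong₂; subst; subst₂; module ≡-Reasoning)

-- Finite sums

∑-cong : ∀ {n} {f g : Fin n → ℤ} → (∀ i → f i ≡ g i) → ∑ f ≡ ∑ g
∑-cong {zero}  e = refl
∑-cong {suc n} e = cong₂ _+_ (e zero) (∑-cong (e ∘ suc))

∑-zero : ∀ {n} {f : Fin n → ℤ} → (∀ i → f i ≡ + 0) → ∑ f ≡ + 0
∑-zero {zero}  e = refl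
∑-zero {suc n} e = cong₂ _+_ (e zero) (∑-zero (e ∘ suc))

∑-distrib-+ : ∀ {n} (f g : Fin n → ℤ) → ∑ (λ i → f i + g i) ≡ ∑ f + ∑ g
∑-distrib-+ {zero}  f g = refl
∑-distrib-+ {suc n} f g =
  trans (cong (_+_ (f zero + g zero)) (∑-distrib-+ (f ∘ suc) (g ∘ suc)))
        (interchange (f zero) (g zero) _ _)
  where
  interchange : ∀ a b c d → (a + b) + (c + d) ≡ (a + c) + (b + d)
  interchange = solve-∀

∑-neg : ∀ {n} (f : Fin n → ℤ) → ∑ (λ i → - f i) ≡ - ∑ f
∑-neg {zero}  f = refl
∑-neg {suc n} f =
  trans (cong (_+_ (- f zero)) (∑-neg (f ∘ suc))) (sym (ℤP.neg-distrib-+ (f zero) _))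

*-distribˡ-∑ : ∀ {n} c (f : Fin n → ℤ) → c * ∑ f ≡ ∑ (λ i → c * f i)
*-distribˡ-∑ {zero}  c f = ℤP.*-zeroʳ c
*-distribˡ-∑ {suc n} c f =
  trans (ℤP.*-distribˡ-+ c (f zero) _) (cong (_+_ (c * f zero)) (*-distribˡ-∑ c (f ∘ suc)))

*-distribʳ-∑ : ∀ {n} c (f : Fin n → ℤ) → ∑ f * c ≡ ∑ (λ i → f i * c)
*-distribʳ-∑ c f =
  trans (ℤP.*-comm (∑ f) c) (trans (*-distribˡ-∑ c f) (∑-cong (λ i → ℤP.*-comm c (f i))))

∑-comm : ∀ {m n} (f : Fin m → Fin n → ℤ) →
         ∑ (λ i → ∑ (λ j → f i j)) ≡ ∑ (λ j → ∑ (λ i → f i j))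
∑-comm {zero} {n} f = sym (∑-zero {n} (λ _ → refl))
∑-comm {suc m} f =
  trans (cong (_+_ (∑ (f zero))) (∑-comm (f ∘ suc)))
        (sym (∑-distrib-+ (f zero) (λ j → ∑ (λ i → f (suc i) j))))

∑-single : ∀ {n} (f : Fin n → ℤ) a → (∀ i → i ≢ a → f i ≡ + 0) → ∑ f ≡ f a
∑-single {suc n} f zero    off =
  trans (cong (_+_ (f zero)) (∑-zero (λ i → off (suc i) λ ()))) (ℤP.+-identityʳ _)
∑-single {suc n} f (suc a) off =
  trans (cong₂ _+_ (off zero λ ())
                   (∑-single (f ∘ suc) a (λ i i≢a → off (suc i) (i≢a ∘ FinP.suc-injective))))
        (ℤP.+-identityˡ _)

∑-nonzero : ∀ {n} (f : Fin n → ℤ) → ∑ f ≢ + 0 → ∃ λ i → f i ≢ + 0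
∑-nonzero {zero}  f ∑f≢0 = ⊥-elim (∑f≢0 refl)
∑-nonzero {suc n} f ∑f≢0 with f zero ℤ.≟ + 0
... | no f0≢0 = zero , f0≢0
... | yes f0≡0 =
  let i , fi≢0 = ∑-nonzero (f ∘ suc) (λ e → ∑f≢0 (cong₂ _+_ f0≡0 e)) in suc i , fi≢0

∏ : ∀ {n} → (Fin n → ℤ) → ℤ
∏ {zero}  f = + 1
∏ {suc n} f = f zero * ∏ (f ∘ suc)

∑Maps : ∀ {l n} → ((Fin l → Fin n) → ℤ) → ℤ
∑Maps {zero}  F = F (λ ())
∑Maps {suc l} F = ∑ (λ k → ∑Maps (λ h → F (k ∷ h)))

∑Maps-cong : ∀ {l n} {F G : (Fin l → Fin n) → ℤ} → (∀ h → F h ≡ G h) → ∑Maps F ≡ ∑Maps G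
∑Maps-cong {zero}  e = e _
∑Maps-cong {suc l} e = ∑-cong (λ k → ∑Maps-cong (λ h → e (k ∷ h)))

∑Maps-zero : ∀ {l n} {F : (Fin l → Fin n) → ℤ} → (∀ h → F h ≡ + 0) → ∑Maps F ≡ + 0
∑Maps-zero {zero}  e = e _
∑Maps-zero {suc l} e = ∑-zero (λ k → ∑Maps-zero (λ h → e (k ∷ h)))

*-distribˡ-∑Maps : ∀ {l n} c (F : (Fin l → Fin n) → ℤ) → c * ∑Maps F ≡ ∑Maps (λ h → c * F h)
*-distribˡ-∑Maps {zero}  c F = refl
*-distribˡ-∑Maps {suc l} c F =
  trans (*-distribˡ-∑ c (λ k → ∑Maps (λ h → F (k ∷ h)))) (∑-cong (λ k → *-distribˡ-∑Maps c (λ h → F (k ∷ h))))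

∑Maps-∑-comm : ∀ {l n m} (F : Fin m → (Fin l → Fin n) → ℤ) →
               ∑Maps (λ h → ∑ (λ i → F i h)) ≡ ∑ (λ i → ∑Maps (F i))
∑Maps-∑-comm {zero}  F = refl
∑Maps-∑-comm {suc l} F =
  trans (∑-cong (λ k → ∑Maps-∑-comm (λ i h → F i (k ∷ h))))
        (∑-comm (λ k i → ∑Maps (λ h → F i (k ∷ h))))

∑Maps-nonzero : ∀ {l n} (F : (Fin l → Fin n) → ℤ) → ∑Maps F ≢ + 0 → ∃ λ h → F h ≢ + 0
∑Maps-nonzero {zero}  F ∑F≢0 = (λ ()) , ∑F≢0
∑Maps-nonzero {suc l} F ∑F≢0 =
  let k , ≢0 = ∑-nonzero _ ∑F≢0
      h , Fh≢0 = ∑Maps-nonzero (λ h → F (k ∷ h)) ≢0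
  in k ∷ h , Fh≢0

-- Determinants

det-cong : ∀ {n} {M N : Matrix n} → M ≐ N → det M ≡ det N
det-cong {zero}  e = refl
det-cong {suc n} e = ∑-cong λ j →
  cong₂ _*_ (cong (sgn (toℕ j) *_) (e zero j)) (det-cong (λ a b → e (suc a) (punchIn j b)))

det-byFirstColumn : ∀ {n} (M : Matrix (suc n)) →
  det M ≡ ∑ (λ i → sgn (toℕ i) * M i zero * det (λ a b → M (punchIn i a) (suc b)))
det-byFirstColumn {zero}  M = refl
det-byFirstColumn {suc n} M = cong (_+_ (+ 1 * M zero zero * det (λ a b → M (suc a) (suc b)))) (begin
    ∑ (λ j → - sgn (toℕ j) * M zero (suc j) * det (λ a b → M (suc a) (punchIn (suc j) b)))
  ≡⟨ ∑-cong (λ j → cong (- sgn (toℕ j) * M zero (suc j) *_)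
                        (det-byFirstColumn (λ a b → M (suc a) (punchIn (suc j) b)))) ⟩
    ∑ (λ j → - sgn (toℕ j) * M zero (suc j) * ∑ (λ i → sgn (toℕ i) * M (suc i) zero * D i j))
  ≡⟨ ∑-cong (λ j → *-distribˡ-∑ (- sgn (toℕ j) * M zero (suc j)) (λ i → sgn (toℕ i) * M (suc i) zero * D i j)) ⟩
    ∑ (λ j → ∑ (λ i → - sgn (toℕ j) * M zero (suc j) * (sgn (toℕ i) * M (suc i) zero * D i j)))
  ≡⟨ ∑-comm (λ j i → - sgn (toℕ j) * M zero (suc j) * (sgn (toℕ i) * M (suc i) zero * D i j)) ⟩
    ∑ (λ i → ∑ (λ j → - sgn (toℕ j) * M zero (suc j) * (sgn (toℕ i) * M (suc i) zero * D i j)))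
  ≡⟨ ∑-cong (λ i → ∑-cong (λ j → exchange (sgn (toℕ j)) (M zero (suc j)) (sgn (toℕ i)) (M (suc i) zero) (D i j))) ⟩
    ∑ (λ i → ∑ (λ j → - sgn (toℕ i) * M (suc i) zero * (sgn (toℕ j) * M zero (suc j) * D i j)))
  ≡⟨ ∑-cong (λ i → sym (*-distribˡ-∑ (- sgn (toℕ i) * M (suc i) zero) (λ j → sgn (toℕ j) * M zero (suc j) * D i j))) ⟩
    ∑ (λ i → - sgn (toℕ i) * M (suc i) zero * det (λ a b → M (punchIn (suc i) a) (suc b)))
  ∎)
  where
  open ≡-Reasoning
  D : Fin (suc n) → Fin (suc n) → ℤ
  D i j = det (λ a b → M (suc (punchIn i a)) (suc (punchIn j b)))
  exchange : ∀ s m s′ m′ d → - s * m * (s′ * m′ * d) ≡ - s′ * m′ * (s * m * d)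
  exchange = solve-∀

det-ᵀ : ∀ {n} (M : Matrix n) → det (M ᵀ) ≡ det M
det-ᵀ {zero}  M = refl
det-ᵀ {suc n} M =
  trans (∑-cong (λ j → cong (sgn (toℕ j) * M j zero *_) (det-ᵀ (λ a b → M (punchIn j a) (suc b)))))
        (sym (det-byFirstColumn M))

-- Expand every column of the product by multilinearity of the determinant.
det-⊗-expansion : ∀ {l n} (W : Fin l → Fin n → ℤ) (V : Fin n → Fin l → ℤ) →
  det (λ a b → ∑ (λ k → W a k * V k b)) ≡
  ∑Maps (λ h → ∏ (λ b → V (h b) b) * det (λ a b → W a (h b)))
det-⊗-expansion {zero}  W V = refl
det-⊗-expansion {suc l} W V = begin
    det (λ a b → ∑ (λ k → W a k * V k b))
  ≡⟨ det-byFirstColumn (λ a b → ∑ (λ k → W a k * V k b)) ⟩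
    ∑ (λ i → sgn (toℕ i) * ∑ (λ k → W i k * V k zero)
             * det (λ a b → ∑ (λ k → W (punchIn i a) k * V k (suc b))))
  ≡⟨ ∑-cong (λ i → cong₂ _*_ (*-distribˡ-∑ (sgn (toℕ i)) (λ k → W i k * V k zero))
                               (det-⊗-expansion (λ a k → W (punchIn i a) k) (λ k b → V k (suc b)))) ⟩
    ∑ (λ i → ∑ (λ k → sgn (toℕ i) * (W i k * V k zero)) * ∑Maps (λ h → P h * D i h))
  ≡⟨ ∑-cong (λ i → *-distribʳ-∑ (∑Maps (λ h → P h * D i h)) (λ k → sgn (toℕ i) * (W i k * V k zero))) ⟩
    ∑ (λ i → ∑ (λ k → sgn (toℕ i) * (W i k * V k zero) * ∑Maps (λ h → P h * D i h)))
  ≡⟨ ∑-cong (λ i → ∑-cong (λ k → *-distribˡ-∑Maps (sgn (toℕ i) * (W i k * V k zero)) (λ h → P h * D i h))) ⟩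
    ∑ (λ i → ∑ (λ k → ∑Maps (λ h → sgn (toℕ i) * (W i k * V k zero) * (P h * D i h))))
  ≡⟨ ∑-comm (λ i k → ∑Maps (λ h → sgn (toℕ i) * (W i k * V k zero) * (P h * D i h))) ⟩
    ∑ (λ k → ∑ (λ i → ∑Maps (λ h → sgn (toℕ i) * (W i k * V k zero) * (P h * D i h))))
  ≡⟨ ∑-cong (λ k → sym (∑Maps-∑-comm (λ i h → sgn (toℕ i) * (W i k * V k zero) * (P h * D i h)))) ⟩
    ∑ (λ k → ∑Maps (λ h → ∑ (λ i → sgn (toℕ i) * (W i k * V k zero) * (P h * D i h))))
  ≡⟨ ∑-cong (λ k → ∑Maps-cong (λ h → ∑-cong (λ i →
       regroup (V k zero) (P h) (sgn (toℕ i)) (W i k) (D i h)))) ⟩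
    ∑ (λ k → ∑Maps (λ h → ∑ (λ i → V k zero * P h * (sgn (toℕ i) * W i k * D i h))))
  ≡⟨ ∑-cong (λ k → ∑Maps-cong (λ h → sym (*-distribˡ-∑ (V k zero * P h) (λ i → sgn (toℕ i) * W i k * D i h)))) ⟩
    ∑ (λ k → ∑Maps (λ h → V k zero * P h * ∑ (λ i → sgn (toℕ i) * W i k * D i h)))
  ≡⟨ ∑-cong (λ k → ∑Maps-cong (λ h →
       cong (V k zero * P h *_) (sym (det-byFirstColumn (λ a b → W a ((k ∷ h) b)))))) ⟩
    ∑Maps (λ h → ∏ (λ b → V (h b) b) * det (λ a b → W a (h b)))
  ∎
  where
  open ≡-Reasoning
  P : (Fin l → Fin _) → ℤ
  P h = ∏ (λ b → V (h b) (suc b))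
  D : Fin (suc l) → (Fin l → Fin _) → ℤ
  D i h = det (λ a b → W (punchIn i a) (h b))
  regroup : ∀ v q s w d → s * (w * v) * (q * d) ≡ v * q * (s * w * d)
  regroup = solve-∀

det-additiveColumn : ∀ {n} (c : Fin n) (M N P : Matrix n) →
  (∀ a b → b ≢ c → M a b ≡ P a b) → (∀ a b → b ≢ c → N a b ≡ P a b) →
  (∀ a → P a c ≡ M a c + N a c) → det P ≡ det M + det N
det-additiveColumn {suc n} c M N P M≈P N≈P P≡M+N =
  trans (∑-cong expand) (∑-distrib-+ (λ j → sgn (toℕ j) * M zero j * det (rowMinor M j))
                                     (λ j → sgn (toℕ j) * N zero j * det (rowMinor N j)))
  where
  open ≡-Reasoning
  rowMinor : Matrix (suc n) → Fin (suc n) → Matrix n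
  rowMinor X j a b = X (suc a) (punchIn j b)
  expand : ∀ j → sgn (toℕ j) * P zero j * det (rowMinor P j)
               ≡ sgn (toℕ j) * M zero j * det (rowMinor M j) + sgn (toℕ j) * N zero j * det (rowMinor N j)
  expand j with j ≟ c
  ... | yes refl = begin
      sgn (toℕ j) * P zero j * det (rowMinor P j)
    ≡⟨ cong₂ (λ x y → sgn (toℕ j) * x * y) (P≡M+N zero) (det-cong (λ a b → sym (M≈P (suc a) (punchIn j b) (FinP.punchInᵢ≢i j b)))) ⟩
      sgn (toℕ j) * (M zero j + N zero j) * det (rowMinor M j)
    ≡⟨ distrib (sgn (toℕ j)) (M zero j) (N zero j) (det (rowMinor M j)) ⟩
      sgn (toℕ j) * M zero j * det (rowMinor M j) + sgn (toℕ j) * N zero j * det (rowMinor M j)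
    ≡⟨ cong (λ y → sgn (toℕ j) * M zero j * det (rowMinor M j) + sgn (toℕ j) * N zero j * y)
            (det-cong (λ a b → trans (M≈P (suc a) (punchIn j b) (FinP.punchInᵢ≢i j b))
                                     (sym (N≈P (suc a) (punchIn j b) (FinP.punchInᵢ≢i j b))))) ⟩
      sgn (toℕ j) * M zero j * det (rowMinor M j) + sgn (toℕ j) * N zero j * det (rowMinor N j)
    ∎
    where
    distrib : ∀ s x y d → s * (x + y) * d ≡ s * x * d + s * y * d
    distrib = solve-∀
  ... | no j≢c = begin
      sgn (toℕ j) * P zero j * det (rowMinor P j)
    ≡⟨ cong₂ (λ x y → sgn (toℕ j) * x * y) (sym (M≈P zero j j≢c)) minor-additive ⟩
      sgn (toℕ j) * M zero j * (det (rowMinor M j) + det (rowMinor N j))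
    ≡⟨ ℤP.*-distribˡ-+ (sgn (toℕ j) * M zero j) (det (rowMinor M j)) (det (rowMinor N j)) ⟩
      sgn (toℕ j) * M zero j * det (rowMinor M j) + sgn (toℕ j) * M zero j * det (rowMinor N j)
    ≡⟨ cong (λ x → sgn (toℕ j) * M zero j * det (rowMinor M j) + sgn (toℕ j) * x * det (rowMinor N j))
            (trans (M≈P zero j j≢c) (sym (N≈P zero j j≢c))) ⟩
      sgn (toℕ j) * M zero j * det (rowMinor M j) + sgn (toℕ j) * N zero j * det (rowMinor N j)
    ∎
    where
    c′ = punchOut j≢c
    avoids-c : ∀ b → b ≢ c′ → punchIn j b ≢ c
    avoids-c b b≢c′ e = b≢c′ (FinP.punchIn-injective j b c′ (trans e (sym (FinP.punchIn-punchOut j≢c))))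
    minor-additive : det (rowMinor P j) ≡ det (rowMinor M j) + det (rowMinor N j)
    minor-additive = det-additiveColumn c′ (rowMinor M j) (rowMinor N j) (rowMinor P j)
      (λ a b b≢c′ → M≈P (suc a) (punchIn j b) (avoids-c b b≢c′))
      (λ a b b≢c′ → N≈P (suc a) (punchIn j b) (avoids-c b b≢c′))
      (λ a → subst (λ z → P (suc a) z ≡ M (suc a) z + N (suc a) z)
                   (sym (FinP.punchIn-punchOut j≢c)) (P≡M+N (suc a)))

∑-cancellingAdjacent : ∀ {k} (f : Fin (suc k) → ℤ) (x : Fin k) →
  (∀ j → j ≢ inject₁ x → j ≢ suc x → f j ≡ + 0) →
  f (inject₁ x) + f (suc x) ≡ + 0 → ∑ f ≡ + 0
∑-cancellingAdjacent {suc k} f zero    others cancel =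
  trans (cong (λ z → f zero + (f (suc zero) + z)) (∑-zero (λ i → others (suc (suc i)) (λ ()) (λ ()))))
        (trans (cong (_+_ (f zero)) (ℤP.+-identityʳ _)) cancel)
∑-cancellingAdjacent {suc k} f (suc x) others cancel =
  cong₂ _+_ (others zero (λ ()) (λ ()))
            (∑-cancellingAdjacent (f ∘ suc) x
              (λ j j≢x j≢x+1 → others (suc j) (j≢x ∘ FinP.suc-injective) (j≢x+1 ∘ FinP.suc-injective))
              cancel)

punchIn-avoidingAdjacent : ∀ {m} (j : Fin (suc (suc m))) (x : Fin (suc m)) →
  j ≢ inject₁ x → j ≢ suc x →
  ∃ λ x′ → punchIn j (inject₁ x′) ≡ inject₁ x × punchIn j (suc x′) ≡ suc x
punchIn-avoidingAdjacent zero          zero    j≢x _     = ⊥-elim (j≢x refl)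
punchIn-avoidingAdjacent zero          (suc x) _   _     = x , refl , refl
punchIn-avoidingAdjacent (suc zero)    zero    _   j≢x+1 = ⊥-elim (j≢x+1 refl)
punchIn-avoidingAdjacent {suc m} (suc (suc j)) zero _ _ = zero , refl , refl
punchIn-avoidingAdjacent {suc m} (suc j) (suc x) j≢x j≢x+1 =
  let x′ , e , e′ = punchIn-avoidingAdjacent j x (j≢x ∘ cong suc) (j≢x+1 ∘ cong suc)
  in suc x′ , cong suc e , cong suc e′

punchIn-adjacent : ∀ {m} (x b : Fin m) →
  punchIn (inject₁ x) b ≡ punchIn (suc x) b ⊎
  (punchIn (inject₁ x) b ≡ suc x × punchIn (suc x) b ≡ inject₁ x)
punchIn-adjacent zero    zero    = inj₂ (refl , refl)
punchIn-adjacent zero    (suc b) = inj₁ refl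
punchIn-adjacent (suc x) zero    = inj₁ refl
punchIn-adjacent (suc x) (suc b) with punchIn-adjacent x b
... | inj₁ e          = inj₁ (cong suc e)
... | inj₂ (e , e′)   = inj₂ (cong suc e , cong suc e′)

-- The two first-row terms at the equal columns cancel: their minors agree and
-- their signs are opposite.
det-adjacentEqualColumns : ∀ {m} (M : Matrix (suc m)) (x : Fin m) →
  (∀ a → M a (inject₁ x) ≡ M a (suc x)) → det M ≡ + 0
det-adjacentEqualColumns {suc m} M x eq =
  ∑-cancellingAdjacent (λ j → sgn (toℕ j) * M zero j * det (rowMinor j)) x others cancel
  where
  rowMinor : Fin (suc (suc m)) → Matrix (suc m)
  rowMinor j a b = M (suc a) (punchIn j b)
  others : ∀ j → j ≢ inject₁ x → j ≢ suc x → sgn (toℕ j) * M zero j * det (rowMinor j) ≡ + 0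
  others j j≢x j≢x+1 =
    let x′ , e , e′ = punchIn-avoidingAdjacent j x j≢x j≢x+1 in
    trans (cong (sgn (toℕ j) * M zero j *_)
                (det-adjacentEqualColumns (rowMinor j) x′
                  (λ a → trans (cong (M (suc a)) e) (trans (eq (suc a)) (cong (M (suc a)) (sym e′))))))
          (ℤP.*-zeroʳ (sgn (toℕ j) * M zero j))
  sameMinor : rowMinor (inject₁ x) ≐ rowMinor (suc x)
  sameMinor a b with punchIn-adjacent x b
  ... | inj₁ e        = cong (M (suc a)) e
  ... | inj₂ (e , e′) = trans (cong (M (suc a)) e) (trans (sym (eq (suc a))) (cong (M (suc a)) (sym e′)))
  cancel : sgn (toℕ (inject₁ x)) * M zero (inject₁ x) * det (rowMinor (inject₁ x))
           + sgn (toℕ (suc x)) * M zero (suc x) * det (rowMinor (suc x)) ≡ + 0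
  cancel = trans (cong₂ _+_ (cong₂ (λ t y → sgn t * M zero (inject₁ x) * y) (FinP.toℕ-inject₁ x) (det-cong sameMinor))
                            (cong (λ y → - sgn (toℕ x) * y * det (rowMinor (suc x))) (sym (eq zero))))
                 (opposite-terms (sgn (toℕ x)) (M zero (inject₁ x)) (det (rowMinor (suc x))))
    where
    opposite-terms : ∀ s y d → s * y * d + - s * y * d ≡ + 0
    opposite-terms = solve-∀

transpose-here : ∀ {n} (i j : Fin n) → transpose i j i ≡ j
transpose-here i j rewrite dec-true (i ≟ i) refl = refl

transpose-elsewhere : ∀ {n} {i j k : Fin n} → k ≢ i → k ≢ j → transpose i j k ≡ k
transpose-elsewhere {i = i} {j} {k} k≢i k≢j rewrite dec-false (k ≟ i) k≢i | dec-false (k ≟ j) k≢j = refl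

replaceColumn : ∀ {n} → Matrix n → Fin n → (Fin n → ℤ) → Matrix n
replaceColumn M c u a b with b ≟ c
... | yes _ = u a
... | no _  = M a b

replaceColumn-here : ∀ {n} (M : Matrix n) c u a → replaceColumn M c u a c ≡ u a
replaceColumn-here M c u a with c ≟ c
... | yes _   = refl
... | no c≢c  = ⊥-elim (c≢c refl)

replaceColumn-elsewhere : ∀ {n} (M : Matrix n) c u a {b} → b ≢ c → replaceColumn M c u a b ≡ M a b
replaceColumn-elsewhere M c u a {b} b≢c with b ≟ c
... | yes b≡c = ⊥-elim (b≢c b≡c)
... | no _    = refl

replaceColumn-self : ∀ {n} (M : Matrix n) c → replaceColumn M c (λ a → M a c) ≐ M
replaceColumn-self M c a b with b ≟ c
... | yes refl = refl
... | no _     = refl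

replaceColumn-congˡ : ∀ {n} (M N : Matrix n) c u b → (∀ a → M a b ≡ N a b) →
                      ∀ a → replaceColumn M c u a b ≡ replaceColumn N c u a b
replaceColumn-congˡ M N c u b M≡N a with b ≟ c
... | yes _ = refl
... | no _  = M≡N a

alternating⇒antisymmetric : ∀ {a} {A : Set a} (_⊕_ : A → A → A) (f : A → A → ℤ) →
  (∀ u v w → f (u ⊕ v) w ≡ f u w + f v w) → (∀ w u v → f w (u ⊕ v) ≡ f w u + f w v) →
  (∀ w → f w w ≡ + 0) → ∀ u v → f v u ≡ - f u v
alternating⇒antisymmetric _⊕_ f additiveˡ additiveʳ alternating u v =
  cancel (f u u) (f u v) (f v u) (f v v) expand (alternating u) (alternating v)
  where
  expand : + 0 ≡ (f u u + f u v) + (f v u + f v v)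
  expand = trans (sym (alternating (u ⊕ v)))
                 (trans (additiveˡ u v (u ⊕ v)) (cong₂ _+_ (additiveʳ u u v) (additiveʳ v u v)))
  cancel : ∀ w x y z → + 0 ≡ (w + x) + (y + z) → w ≡ + 0 → z ≡ + 0 → y ≡ - x
  cancel w x y z e refl refl = trans (regroup x y) (trans (cong (_+_ (- x)) (sym e)) (ℤP.+-identityʳ (- x)))
    where
    regroup : ∀ x y → y ≡ - x + ((+ 0 + x) + (y + + 0))
    regroup = solve-∀

det-antisymmetricColumns : ∀ {n} {c d : Fin n} → c ≢ d →
  (∀ N → (∀ a → N a c ≡ N a d) → det N ≡ + 0) →
  ∀ M → det (λ a b → M a (transpose c d b)) ≡ - det M
det-antisymmetricColumns {n} {c} {d} c≢d alternating M = begin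
    det (λ a b → M a (transpose c d b))  ≡⟨ det-cong swapped ⟩
    det (S (column d) (column c))        ≡⟨ alternating⇒antisymmetric _+ᶜ_ (λ u v → det (S u v))
                                               additiveˡ additiveʳ alternatingˢ (column c) (column d) ⟩
    - det (S (column c) (column d))      ≡⟨ cong -_ (det-cong original) ⟩
    - det M                              ∎
  where
  open ≡-Reasoning
  column : Fin n → Fin n → ℤ
  column b a = M a b
  _+ᶜ_ : (Fin n → ℤ) → (Fin n → ℤ) → Fin n → ℤ
  (u +ᶜ v) a = u a + v a
  S : (Fin n → ℤ) → (Fin n → ℤ) → Matrix n
  S u v = replaceColumn (replaceColumn M d v) c u
  S-at-d : ∀ u v a → S u v a d ≡ v a
  S-at-d u v a = trans (replaceColumn-elsewhere _ c u a (c≢d ∘ sym)) (replaceColumn-here M d v a)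
  alternatingˢ : ∀ w → det (S w w) ≡ + 0
  alternatingˢ w = alternating (S w w) (λ a → trans (replaceColumn-here _ c w a) (sym (S-at-d w w a)))
  additiveˡ : ∀ u v w → det (S (u +ᶜ v) w) ≡ det (S u w) + det (S v w)
  additiveˡ u v w = det-additiveColumn c (S u w) (S v w) (S (u +ᶜ v) w)
    (λ a b b≢c → trans (replaceColumn-elsewhere _ c u a b≢c) (sym (replaceColumn-elsewhere _ c (u +ᶜ v) a b≢c)))
    (λ a b b≢c → trans (replaceColumn-elsewhere _ c v a b≢c) (sym (replaceColumn-elsewhere _ c (u +ᶜ v) a b≢c)))
    (λ a → trans (replaceColumn-here _ c (u +ᶜ v) a) (sym (cong₂ _+_ (replaceColumn-here _ c u a) (replaceColumn-here _ c v a))))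
  additiveʳ : ∀ w u v → det (S w (u +ᶜ v)) ≡ det (S w u) + det (S w v)
  additiveʳ w u v = det-additiveColumn d (S w u) (S w v) (S w (u +ᶜ v)) (agree u) (agree v)
    (λ a → trans (S-at-d w (u +ᶜ v) a) (sym (cong₂ _+_ (S-at-d w u a) (S-at-d w v a))))
    where
    agree : ∀ x a b → b ≢ d → S w x a b ≡ S w (u +ᶜ v) a b
    agree x a b b≢d = replaceColumn-congˡ (replaceColumn M d x) (replaceColumn M d (u +ᶜ v)) c w b
      (λ a → trans (replaceColumn-elsewhere M d x a b≢d) (sym (replaceColumn-elsewhere M d (u +ᶜ v) a b≢d))) a
  original : S (column c) (column d) ≐ M
  original a b with b ≟ c
  ... | yes refl = refl
  ... | no _     = replaceColumn-self M d a b
  swapped : ∀ a b → M a (transpose c d b) ≡ S (column d) (column c) a b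
  swapped a b with b ≟ c
  ... | yes _ = refl
  ... | no _ with b ≟ d
  ...   | yes _ = refl
  ...   | no _  = refl

inject₁≢suc : ∀ {m} (x : Fin m) → inject₁ x ≢ suc x
inject₁≢suc zero    ()
inject₁≢suc (suc x) e = inject₁≢suc x (FinP.suc-injective e)

-- Swapping the adjacent columns x and x + 1 moves the copy of column c one step
-- closer to it; k bounds the number of steps.
det-equalColumnsUpTo : ∀ k {m} (M : Matrix (suc m)) c (x : Fin m) → toℕ x ≡ k →
  toℕ c ℕ.≤ toℕ x → (∀ a → M a c ≡ M a (suc x)) → det M ≡ + 0
det-equalColumnsUpTo k M c x _ _ eq with c ≟ inject₁ x
... | yes refl = det-adjacentEqualColumns M x eq
det-equalColumnsUpTo k M c zero _ c≤0 _ | no c≢0 = ⊥-elim (c≢0 (FinP.toℕ-injective (ℕP.n≤0⇒n≡0 c≤0)))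
det-equalColumnsUpTo zero M c (suc x′) () _ _ | no _
det-equalColumnsUpTo (suc k) {suc m} M c (suc x′) x≡k c≤x eq | no c≢x =
  ℤP.neg-injective (trans (sym (det-antisymmetricColumns (inject₁≢suc x) (λ N → det-adjacentEqualColumns N x) M))
                          swapped-vanishes)
  where
  x = suc x′
  τ = transpose (inject₁ x) (suc x)
  c<x : toℕ c ℕ.< toℕ x
  c<x = ℕP.≤∧≢⇒< c≤x (λ e → c≢x (FinP.toℕ-injective (trans e (sym (FinP.toℕ-inject₁ x)))))
  c≢x+1 : c ≢ suc x
  c≢x+1 refl = ℕP.<-asym c<x (ℕP.n<1+n (toℕ x))
  swapped-vanishes : det (λ a b → M a (τ b)) ≡ + 0
  swapped-vanishes = det-equalColumnsUpTo k (λ a b → M a (τ b)) c (inject₁ x′)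
    (trans (FinP.toℕ-inject₁ x′) (ℕP.suc-injective x≡k))
    (subst (toℕ c ℕ.≤_) (sym (FinP.toℕ-inject₁ x′)) (ℕ.s≤s⁻¹ c<x))
    (λ a → trans (cong (M a) (transpose-elsewhere c≢x c≢x+1))
                 (trans (eq a) (cong (M a) (sym (transpose-here (inject₁ x) (suc x))))))

det-equalColumns< : ∀ {n} (M : Matrix n) {c d} → toℕ c ℕ.< toℕ d →
                    (∀ a → M a c ≡ M a d) → det M ≡ + 0
det-equalColumns< M {c} {suc x} c<d = det-equalColumnsUpTo (toℕ x) M c x refl (ℕ.s≤s⁻¹ c<d)

det-equalColumns : ∀ {n} (M : Matrix n) {c d} → c ≢ d → (∀ a → M a c ≡ M a d) → det M ≡ + 0
det-equalColumns M {c} {d} c≢d eq with FinP.<-cmp c d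
... | tri< c<d _ _ = det-equalColumns< M c<d eq
... | tri≈ _ c≡d _ = ⊥-elim (c≢d c≡d)
... | tri> _ _ d<c = det-equalColumns< M d<c (sym ∘ eq)

det-swapColumns : ∀ {n} {c d : Fin n} → c ≢ d → ∀ M → det (λ a b → M a (transpose c d b)) ≡ - det M
det-swapColumns c≢d = det-antisymmetricColumns c≢d (λ N → det-equalColumns N c≢d)

ScalesDet : ∀ {n} → (Fin n → Fin n) → Set
ScalesDet h = Σ ℤ λ ε → ∀ M → det (λ a b → M a (h b)) ≡ ε * det M

FixesFrom : ∀ {n} → ℕ → (Fin n → Fin n) → Set
FixesFrom k h = ∀ b → k ℕ.≤ toℕ b → h b ≡ b

-- Either h is not injective, or composing it with a transposition makes it fix c.
scalesDet-fixingOneMore : ∀ {n} k (c : Fin n) → toℕ c ≡ k →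
  (∀ h → FixesFrom k h → ScalesDet h) → ∀ h → FixesFrom (suc k) h → ScalesDet h
scalesDet-fixingOneMore k c c≡k rec h fixed with h c ≟ c
... | yes hc≡c = rec h fixed′
  where
  fixed′ : FixesFrom k h
  fixed′ b k≤b with ℕP.m≤n⇒m<n∨m≡n k≤b
  ... | inj₁ k<b = fixed b k<b
  ... | inj₂ k≡b = subst (λ z → h z ≡ z) (FinP.toℕ-injective (trans c≡k k≡b)) hc≡c
... | no hc≢c with suc k ℕ.≤? toℕ (h c)
...   | yes k<hc = + 0 , λ M →
  trans (det-equalColumns (λ a b → M a (h b)) hc≢c (λ a → cong (M a) (fixed (h c) k<hc)))
        (sym (ℤP.*-zeroˡ (det M)))
...   | no k≮hc = - ε′ , λ M → begin
    det (λ a b → M a (h b))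
  ≡⟨ det-cong (λ a b → cong (M a) (sym (transpose-inverse c (h c)))) ⟩
    det (λ a b → M a (τ (h′ b)))
  ≡⟨ scales (λ a b → M a (τ b)) ⟩
    ε′ * det (λ a b → M a (τ b))
  ≡⟨ cong (ε′ *_) (det-swapColumns (hc≢c ∘ sym) M) ⟩
    ε′ * - det M
  ≡⟨ ℤP.neg-distribʳ-* ε′ (det M) ⟨
    - (ε′ * det M)
  ≡⟨ ℤP.neg-distribˡ-* ε′ (det M) ⟩
    - ε′ * det M
  ∎
  where
  open ≡-Reasoning
  τ = transpose c (h c)
  h′ : Fin _ → Fin _
  h′ b = transpose (h c) c (h b)
  fixed′ : FixesFrom k h′
  fixed′ b k≤b with ℕP.m≤n⇒m<n∨m≡n k≤b
  ... | inj₂ k≡b = subst (λ z → h′ z ≡ z) (FinP.toℕ-injective (trans c≡k k≡b)) (transpose-here (h c) c)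
  ... | inj₁ k<b = trans (cong (transpose (h c) c) (fixed b k<b)) (transpose-elsewhere b≢hc b≢c)
    where
    b≢c : b ≢ c
    b≢c refl = ℕP.<-irrefl (sym c≡k) k<b
    b≢hc : b ≢ h c
    b≢hc refl = k≮hc k<b
  ε′ = proj₁ (rec h′ fixed′)
  scales = proj₂ (rec h′ fixed′)

det-reindexColumns : ∀ {n} (h : Fin n → Fin n) → ScalesDet h
det-reindexColumns {n} h = fixingFrom n h (λ b n≤b → ⊥-elim (ℕP.<⇒≱ (FinP.toℕ<n b) n≤b))
  where
  fixingFrom : ∀ k h → FixesFrom k h → ScalesDet h
  fixingFrom zero    h fixed = + 1 , λ M →
    trans (det-cong (λ a b → cong (M a) (fixed b z≤n))) (sym (ℤP.*-identityˡ (det M)))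
  fixingFrom (suc k) h fixed with k ℕ.<? n
  ... | yes k<n = scalesDet-fixingOneMore k (fromℕ< k<n) (FinP.toℕ-fromℕ< k<n) (fixingFrom k) h fixed
  ... | no k≮n  = fixingFrom k h (λ b k≤b → ⊥-elim (k≮n (ℕP.≤-<-trans k≤b (FinP.toℕ<n b))))

Id : ∀ {n} → Matrix n
Id zero    zero    = + 1
Id zero    (suc _) = + 0
Id (suc _) zero    = + 0
Id (suc a) (suc b) = Id a b

Id-diag : ∀ {n} (a : Fin n) → Id a a ≡ + 1
Id-diag zero    = refl
Id-diag (suc a) = Id-diag a

Id-offDiag : ∀ {n} {a b : Fin n} → a ≢ b → Id a b ≡ + 0
Id-offDiag {a = zero}  {zero}  a≢b = ⊥-elim (a≢b refl)
Id-offDiag {a = zero}  {suc b} _   = refl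
Id-offDiag {a = suc a} {zero}  _   = refl
Id-offDiag {a = suc a} {suc b} a≢b = Id-offDiag (a≢b ∘ cong suc)

∑-*Id : ∀ {n} (f : Fin n → ℤ) a → ∑ (λ l → f l * Id l a) ≡ f a
∑-*Id f a =
  trans (∑-single (λ l → f l * Id l a) a (λ l l≢a → trans (cong (f l *_) (Id-offDiag l≢a)) (ℤP.*-zeroʳ (f l))))
        (trans (cong (f a *_) (Id-diag a)) (ℤP.*-identityʳ (f a)))

∑-Id* : ∀ {n} (f : Fin n → ℤ) a → ∑ (λ l → Id a l * f l) ≡ f a
∑-Id* f a =
  trans (∑-single (λ l → Id a l * f l) a (λ l l≢a → trans (cong (_* f l) (Id-offDiag (l≢a ∘ sym))) (ℤP.*-zeroˡ (f l))))
        (trans (cong (_* f a) (Id-diag a)) (ℤP.*-identityˡ (f a)))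

det-Id : ∀ {n} → det (Id {n}) ≡ + 1
det-Id {zero}  = refl
det-Id {suc n} =
  trans (∑-single {suc n} (λ j → sgn (toℕ j) * Id zero j * det (λ a b → Id (suc a) (punchIn j b))) zero
                  (λ { zero 0≢0 → ⊥-elim (0≢0 refl)
                     ; (suc j) _ → zero-entry (sgn (toℕ (suc j))) (det (λ a b → Id (suc a) (punchIn (suc j) b))) }))
        (trans (ℤP.*-identityˡ (det (Id {n}))) (det-Id {n}))
  where
  zero-entry : ∀ s d → s * + 0 * d ≡ + 0
  zero-entry = solve-∀

-- Reindexing the columns of A scales det A by a factor independent of A, so
-- det (A ⊗ B) = det A * c B, and A = Id identifies c B with det B.
det-⊗ : ∀ {n} (A B : Matrix n) → det (A ⊗ B) ≡ det A * det B
det-⊗ {n} A B = trans (factorises A) (cong (det A *_) (sym det≡factor))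
  where
  scale : (Fin n → Fin n) → ℤ
  scale h = proj₁ (det-reindexColumns h)
  factor : ℤ
  factor = ∑Maps (λ h → ∏ (λ b → B (h b) b) * scale h)
  factorises : ∀ A → det (A ⊗ B) ≡ det A * factor
  factorises A = begin
      det (A ⊗ B)
    ≡⟨ det-⊗-expansion A B ⟩
      ∑Maps (λ h → ∏ (λ b → B (h b) b) * det (λ a b → A a (h b)))
    ≡⟨ ∑Maps-cong (λ h → cong (∏ (λ b → B (h b) b) *_) (proj₂ (det-reindexColumns h) A)) ⟩
      ∑Maps (λ h → ∏ (λ b → B (h b) b) * (scale h * det A))
    ≡⟨ ∑Maps-cong (λ h → rotate (∏ (λ b → B (h b) b)) (scale h) (det A)) ⟩
      ∑Maps (λ h → det A * (∏ (λ b → B (h b) b) * scale h))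
    ≡⟨ *-distribˡ-∑Maps (det A) (λ h → ∏ (λ b → B (h b) b) * scale h) ⟨
      det A * factor
    ∎
    where
    open ≡-Reasoning
    rotate : ∀ p e d → p * (e * d) ≡ d * (p * e)
    rotate = solve-∀
  det≡factor : det B ≡ factor
  det≡factor = begin
    det B                  ≡⟨ det-cong (λ a b → ∑-Id* (λ k → B k b) a) ⟨
    det (Id ⊗ B)           ≡⟨ factorises Id ⟩
    det (Id {n}) * factor  ≡⟨ cong (_* factor) (det-Id {n}) ⟩
    + 1 * factor           ≡⟨ ℤP.*-identityˡ factor ⟩
    factor                 ∎
    where open ≡-Reasoning

∣i∣≡1⇒±1 : ∀ {i} → ∣ i ∣ ≡ 1 → i ≡ + 1 ⊎ i ≡ - (+ 1)
∣i∣≡1⇒±1 {+ 1}              _  = inj₁ refl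
∣i∣≡1⇒±1 { -[1+ 0 ]}        _  = inj₂ refl
∣i∣≡1⇒±1 {+ 0}              ()
∣i∣≡1⇒±1 {+ suc (suc _)}    ()
∣i∣≡1⇒±1 { -[1+ suc _ ]}    ()

*≡1⇒±1 : ∀ i j → i * j ≡ + 1 → j ≡ + 1 ⊎ j ≡ - (+ 1)
*≡1⇒±1 i j ij≡1 = ∣i∣≡1⇒±1 (ℕP.m*n≡1⇒n≡1 ∣ i ∣ ∣ j ∣ (trans (sym (ℤP.abs-* i j)) (cong ∣_∣ ij≡1)))

-- Invariants of integral congruence

congruence-entry : ∀ {n} (B Z : Matrix n) i j →
  ((B ᵀ) ⊗ (Z ⊗ B)) i j ≡ ∑ (λ k → ∑ (λ m → B k i * Z k m * B m j))
congruence-entry B Z i j = ∑-cong λ k →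
  trans (*-distribˡ-∑ (B k i) (λ m → Z k m * B m j)) (∑-cong (λ m → sym (ℤP.*-assoc (B k i) (Z k m) (B m j))))

congruence-symmetrise : ∀ {n} (B X Y : Matrix n) → X ≐ ((B ᵀ) ⊗ (Y ⊗ B)) →
  (X ⊕ (X ᵀ)) ≐ ((B ᵀ) ⊗ ((Y ⊕ (Y ᵀ)) ⊗ B))
congruence-symmetrise B X Y X≐BᵀYB i j = begin
    X i j + X j i
  ≡⟨ cong₂ _+_ (trans (X≐BᵀYB i j) (congruence-entry B Y i j))
               (trans (X≐BᵀYB j i) (trans (congruence-entry B Y j i) (∑-comm (λ k m → B k j * Y k m * B m i)))) ⟩
    ∑ (λ k → ∑ (λ m → B k i * Y k m * B m j)) + ∑ (λ k → ∑ (λ m → B m j * Y m k * B k i))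
  ≡⟨ ∑-distrib-+ (λ k → ∑ (λ m → B k i * Y k m * B m j)) (λ k → ∑ (λ m → B m j * Y m k * B k i)) ⟨
    ∑ (λ k → ∑ (λ m → B k i * Y k m * B m j) + ∑ (λ m → B m j * Y m k * B k i))
  ≡⟨ ∑-cong (λ k → ∑-distrib-+ (λ m → B k i * Y k m * B m j) (λ m → B m j * Y m k * B k i)) ⟨
    ∑ (λ k → ∑ (λ m → B k i * Y k m * B m j + B m j * Y m k * B k i))
  ≡⟨ ∑-cong (λ k → ∑-cong (λ m → distrib (B k i) (Y k m) (Y m k) (B m j))) ⟨
    ∑ (λ k → ∑ (λ m → B k i * (Y k m + Y m k) * B m j))
  ≡⟨ congruence-entry B (Y ⊕ (Y ᵀ)) i j ⟨
    ((B ᵀ) ⊗ ((Y ⊕ (Y ᵀ)) ⊗ B)) i j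
  ∎
  where
  open ≡-Reasoning
  distrib : ∀ b y y′ c → b * (y + y′) * c ≡ b * y * c + c * y′ * b
  distrib = solve-∀

bilinForm : ∀ {n} → Matrix n → (Fin n → ℤ) → (Fin n → ℤ) → ℤ
bilinForm M x y = ∑ (λ i → ∑ (λ j → x i * M i j * y j))

_·_ : ∀ {n} → Matrix n → (Fin n → ℤ) → Fin n → ℤ
(M · x) k = ∑ (λ i → M k i * x i)

bilinForm-congˡ : ∀ {n} {M N : Matrix n} → M ≐ N → ∀ x y → bilinForm M x y ≡ bilinForm N x y
bilinForm-congˡ M≐N x y = ∑-cong (λ i → ∑-cong (λ j → cong (λ z → x i * z * y j) (M≐N i j)))

bilinForm-congʳ : ∀ {n} (M : Matrix n) {x x′ y y′ : Fin n → ℤ} →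
  (∀ i → x i ≡ x′ i) → (∀ j → y j ≡ y′ j) → bilinForm M x y ≡ bilinForm M x′ y′
bilinForm-congʳ M x≡x′ y≡y′ = ∑-cong (λ i → ∑-cong (λ j → cong₂ (λ u v → u * M i j * v) (x≡x′ i) (y≡y′ j)))

bilinForm-Id : ∀ {n} (M : Matrix n) i j → bilinForm M (λ k → Id k i) (λ m → Id m j) ≡ M i j
bilinForm-Id M i j =
  trans (∑-cong (λ k → ∑-*Id (λ m → Id k i * M k m) j))
        (trans (∑-cong (λ k → ℤP.*-comm (Id k i) (M k j))) (∑-*Id (λ k → M k j) i))

bilinForm-congruence : ∀ {n} (B Z : Matrix n) (x y : Fin n → ℤ) →
  bilinForm ((B ᵀ) ⊗ (Z ⊗ B)) x y ≡ bilinForm Z (B · x) (B · y)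
bilinForm-congruence B Z x y = begin
    ∑ (λ i → ∑ (λ j → x i * ((B ᵀ) ⊗ (Z ⊗ B)) i j * y j))
  ≡⟨ ∑-cong (λ i → ∑-cong (λ j → trans (cong (λ z → x i * z * y j) (congruence-entry B Z i j))
                                  (trans (sandwich (x i) (y j) (λ k → ∑ (λ m → B k i * Z k m * B m j)))
                                         (∑-cong (λ k → sandwich (x i) (y j) (λ m → B k i * Z k m * B m j)))))) ⟩
    ∑ (λ i → ∑ (λ j → ∑ (λ k → ∑ (λ m → x i * (B k i * Z k m * B m j) * y j))))
  ≡⟨ ∑-cong (λ i → ∑-comm (λ j k → ∑ (λ m → x i * (B k i * Z k m * B m j) * y j))) ⟩
    ∑ (λ i → ∑ (λ k → ∑ (λ j → ∑ (λ m → x i * (B k i * Z k m * B m j) * y j))))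
  ≡⟨ ∑-comm (λ i k → ∑ (λ j → ∑ (λ m → x i * (B k i * Z k m * B m j) * y j))) ⟩
    ∑ (λ k → ∑ (λ i → ∑ (λ j → ∑ (λ m → x i * (B k i * Z k m * B m j) * y j))))
  ≡⟨ ∑-cong (λ k → ∑-cong (λ i → ∑-comm (λ j m → x i * (B k i * Z k m * B m j) * y j))) ⟩
    ∑ (λ k → ∑ (λ i → ∑ (λ m → ∑ (λ j → x i * (B k i * Z k m * B m j) * y j))))
  ≡⟨ ∑-cong (λ k → ∑-comm (λ i m → ∑ (λ j → x i * (B k i * Z k m * B m j) * y j))) ⟩
    ∑ (λ k → ∑ (λ m → ∑ (λ i → ∑ (λ j → x i * (B k i * Z k m * B m j) * y j))))
  ≡⟨ ∑-cong (λ k → ∑-cong (λ m → ∑-cong (λ i → ∑-cong (λ j →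
       regroup (x i) (B k i) (Z k m) (B m j) (y j))))) ⟩
    ∑ (λ k → ∑ (λ m → ∑ (λ i → ∑ (λ j → B k i * x i * Z k m * (B m j * y j)))))
  ≡⟨ ∑-cong (λ k → ∑-cong (λ m → outer (Z k m) (λ i → B k i * x i) (λ j → B m j * y j))) ⟨
    bilinForm Z (B · x) (B · y)
  ∎
  where
  open ≡-Reasoning
  sandwich : ∀ {n} (a c : ℤ) (f : Fin n → ℤ) → a * ∑ f * c ≡ ∑ (λ k → a * f k * c)
  sandwich a c f = trans (cong (_* c) (*-distribˡ-∑ a f)) (*-distribʳ-∑ c (λ k → a * f k))
  outer : ∀ {n} (c : ℤ) (f g : Fin n → ℤ) → ∑ f * c * ∑ g ≡ ∑ (λ i → ∑ (λ j → f i * c * g j))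
  outer c f g = trans (cong (_* ∑ g) (*-distribʳ-∑ c f))
    (trans (*-distribʳ-∑ (∑ g) (λ i → f i * c)) (∑-cong (λ i → *-distribˡ-∑ (f i * c) g)))
  regroup : ∀ xi bki zkm bmj yj → xi * (bki * zkm * bmj) * yj ≡ bki * xi * zkm * (bmj * yj)
  regroup = solve-∀

congruence-involutive : ∀ {n} (B X Y : Matrix n) → (B ⊗ B) ≐ Id →
  X ≐ ((B ᵀ) ⊗ (Y ⊗ B)) → Y ≐ ((B ᵀ) ⊗ (X ⊗ B))
congruence-involutive B X Y B²≐Id X≐BᵀYB i j = sym (begin
    ((B ᵀ) ⊗ (X ⊗ B)) i j
  ≡⟨ congruence-entry B X i j ⟩
    bilinForm X (λ k → B k i) (λ m → B m j)
  ≡⟨ bilinForm-congˡ X≐BᵀYB (λ k → B k i) (λ m → B m j) ⟩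
    bilinForm ((B ᵀ) ⊗ (Y ⊗ B)) (λ k → B k i) (λ m → B m j)
  ≡⟨ bilinForm-congruence B Y (λ k → B k i) (λ m → B m j) ⟩
    bilinForm Y (λ k → (B ⊗ B) k i) (λ m → (B ⊗ B) m j)
  ≡⟨ bilinForm-congʳ Y (λ k → B²≐Id k i) (λ m → B²≐Id m j) ⟩
    bilinForm Y (λ k → Id k i) (λ m → Id m j)
  ≡⟨ bilinForm-Id Y i j ⟩
    Y i j
  ∎)
  where open ≡-Reasoning

PSD-congruence : ∀ {n} (B X Y : Matrix n) → X ≐ ((B ᵀ) ⊗ (Y ⊗ B)) → PSD Y → PSD X
PSD-congruence B X Y X≐BᵀYB Y-psd x =
  subst (+ 0 ℤ.≤_)
        (sym (trans (bilinForm-congˡ X≐BᵀYB x x) (bilinForm-congruence B Y x x)))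
        (Y-psd (B · x))

det-minor-congruence : ∀ {n l} (B Z : Matrix n) (f g : Fin l → Fin n) →
  det (minor ((B ᵀ) ⊗ (Z ⊗ B)) f g) ≡
  ∑Maps (λ h → ∏ (λ b → B (h b) (g b)) * ∑Maps (λ h′ → ∏ (λ a → B (h′ a) (f a)) * det (minor Z h′ h)))
det-minor-congruence {n} {l} B Z f g = begin
    det (minor ((B ᵀ) ⊗ (Z ⊗ B)) f g)
  ≡⟨ det-cong (λ a b → reassociate (λ k → B k (f a)) (λ m → B m (g b))) ⟩
    det (λ a b → ∑ (λ m → W a m * B m (g b)))
  ≡⟨ det-⊗-expansion W (λ m b → B m (g b)) ⟩
    ∑Maps (λ h → ∏ (λ b → B (h b) (g b)) * det (λ a b → W a (h b)))
  ≡⟨ ∑Maps-cong (λ h → cong (∏ (λ b → B (h b) (g b)) *_) (begin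
       det (λ a b → W a (h b))
     ≡⟨ det-ᵀ (λ a b → W a (h b)) ⟨
       det (λ b a → ∑ (λ k → B k (f a) * Z k (h b)))
     ≡⟨ det-cong (λ b a → ∑-cong (λ k → ℤP.*-comm (B k (f a)) (Z k (h b)))) ⟩
       det (λ b a → ∑ (λ k → Z k (h b) * B k (f a)))
     ≡⟨ det-⊗-expansion (λ b k → Z k (h b)) (λ k a → B k (f a)) ⟩
       ∑Maps (λ h′ → ∏ (λ a → B (h′ a) (f a)) * det (λ b a → Z (h′ a) (h b)))
     ≡⟨ ∑Maps-cong (λ h′ → cong (∏ (λ a → B (h′ a) (f a)) *_) (det-ᵀ (minor Z h′ h))) ⟩
       ∑Maps (λ h′ → ∏ (λ a → B (h′ a) (f a)) * det (minor Z h′ h))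
     ∎)) ⟩
    ∑Maps (λ h → ∏ (λ b → B (h b) (g b)) * ∑Maps (λ h′ → ∏ (λ a → B (h′ a) (f a)) * det (minor Z h′ h)))
  ∎
  where
  open ≡-Reasoning
  W : Fin l → Fin n → ℤ
  W a m = ∑ (λ k → B k (f a) * Z k m)
  reassociate : (x z : Fin n → ℤ) → ∑ (λ k → x k * ∑ (λ m → Z k m * z m)) ≡ ∑ (λ m → ∑ (λ k → x k * Z k m) * z m)
  reassociate x z =
    trans (∑-cong (λ k → trans (*-distribˡ-∑ (x k) (λ m → Z k m * z m))
                               (∑-cong (λ m → sym (ℤP.*-assoc (x k) (Z k m) (z m))))))
    (trans (∑-comm (λ k m → x k * Z k m * z m))
           (∑-cong (λ m → sym (*-distribʳ-∑ (z m) (λ k → x k * Z k m)))))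

det≢0⇒injectiveColumns : ∀ {l n} (W : Fin l → Fin n → ℤ) (g : Fin l → Fin n) →
  det (λ a b → W a (g b)) ≢ + 0 → Injective _≡_ _≡_ g
det≢0⇒injectiveColumns W g det≢0 {x} {y} gx≡gy with x ≟ y
... | yes x≡y = x≡y
... | no x≢y  = ⊥-elim (det≢0 (det-equalColumns (λ a b → W a (g b)) x≢y (λ a → cong (W a) gx≡gy)))

det-minor≢0⇒injective : ∀ {n l} (Z : Matrix n) (f g : Fin l → Fin n) →
  det (minor Z f g) ≢ + 0 → Injective _≡_ _≡_ f × Injective _≡_ _≡_ g
det-minor≢0⇒injective Z f g det≢0 =
  det≢0⇒injectiveColumns (λ b k → Z k (g b)) f (det≢0 ∘ trans (sym (det-ᵀ (minor Z f g)))) ,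
  det≢0⇒injectiveColumns (λ a k → Z (f a) k) g det≢0

MinorsVanish : ∀ {n} → Matrix n → ℕ → Set
MinorsVanish {n} Z l = ∀ (f g : Fin l → Fin n) →
  Injective _≡_ _≡_ f → Injective _≡_ _≡_ g → det (minor Z f g) ≡ + 0

minorsVanish⇒allMinorsVanish : ∀ {n l} (Z : Matrix n) → MinorsVanish Z l →
  ∀ (f g : Fin l → Fin n) → det (minor Z f g) ≡ + 0
minorsVanish⇒allMinorsVanish Z vanish f g with det (minor Z f g) ℤ.≟ + 0
... | yes det≡0 = det≡0
... | no det≢0  = let f-inj , g-inj = det-minor≢0⇒injective Z f g det≢0
                  in ⊥-elim (det≢0 (vanish f g f-inj g-inj))

minorsVanish-congruence : ∀ {n l} (B Z : Matrix n) → MinorsVanish Z l → MinorsVanish ((B ᵀ) ⊗ (Z ⊗ B)) l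
minorsVanish-congruence B Z vanish f g _ _ =
  trans (det-minor-congruence B Z f g)
        (∑Maps-zero (λ h → trans (cong (∏ (λ b → B (h b) (g b)) *_)
           (∑Maps-zero (λ h′ → trans (cong (∏ (λ a → B (h′ a) (f a)) *_) (minorsVanish⇒allMinorsVanish Z vanish h′ h))
                                     (ℤP.*-zeroʳ (∏ (λ a → B (h′ a) (f a)))))))
           (ℤP.*-zeroʳ (∏ (λ b → B (h b) (g b))))))

nonzeroMinor-congruence : ∀ {n l} (B Z : Matrix n) (f g : Fin l → Fin n) →
  det (minor ((B ᵀ) ⊗ (Z ⊗ B)) f g) ≢ + 0 →
  Σ[ f′ ∈ (Fin l → Fin n) ] Σ[ g′ ∈ (Fin l → Fin n) ]
    Injective _≡_ _≡_ f′ × Injective _≡_ _≡_ g′ × det (minor Z f′ g′) ≢ + 0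
nonzeroMinor-congruence B Z f g det≢0 =
  let g′ , outer≢0 = ∑Maps-nonzero _ (det≢0 ∘ trans (det-minor-congruence B Z f g))
      f′ , inner≢0 = ∑Maps-nonzero _ (factor≢0 (∏ (λ b → B (g′ b) (g b))) outer≢0)
      minor≢0 = factor≢0 (∏ (λ a → B (f′ a) (f a))) inner≢0
      f′-inj , g′-inj = det-minor≢0⇒injective Z f′ g′ minor≢0
  in f′ , g′ , f′-inj , g′-inj , minor≢0
  where
  factor≢0 : ∀ a {b} → a * b ≢ + 0 → b ≢ + 0
  factor≢0 a ab≢0 b≡0 = ab≢0 (trans (cong (a *_) b≡0) (ℤP.*-zeroʳ a))

HasRank-congruence : ∀ {n} (B X Y : Matrix n) → X ≐ ((B ᵀ) ⊗ (Y ⊗ B)) → Y ≐ ((B ᵀ) ⊗ (X ⊗ B)) →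
  ∀ k → HasRank Y k → HasRank X k
HasRank-congruence B X Y X≐BᵀYB Y≐BᵀXB k ((f , g , _ , _ , Y-minor≢0) , Y-vanish) =
  nonzeroMinor-congruence B X f g (Y-minor≢0 ∘ trans (det-cong (λ a b → Y≐BᵀXB (f a) (g b)))) ,
  λ l k<l f g f-inj g-inj →
    trans (det-cong (λ a b → X≐BᵀYB (f a) (g b))) (minorsVanish-congruence B Y (Y-vanish l k<l) f g f-inj g-inj)

NonNegCorank-congruence : ∀ {n} (B X Y : Matrix n) → X ≐ ((B ᵀ) ⊗ (Y ⊗ B)) → Y ≐ ((B ᵀ) ⊗ (X ⊗ B)) →
  ∀ r′ → NonNegCorank Y r′ → NonNegCorank X r′
NonNegCorank-congruence B X Y X≐BᵀYB Y≐BᵀXB r′ (r′≤n , psd , rank) =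
  r′≤n ,
  PSD-congruence B (X ⊕ (X ᵀ)) (Y ⊕ (Y ᵀ)) (congruence-symmetrise B X Y X≐BᵀYB) psd ,
  HasRank-congruence B (X ⊕ (X ᵀ)) (Y ⊕ (Y ᵀ))
    (congruence-symmetrise B X Y X≐BᵀYB) (congruence-symmetrise B Y X Y≐BᵀXB) _ rank

-- The reflection matrix of an anchored path

module PathReflection {n r : ℕ} (p : Fin n) (s : Fin r → Fin n)
                      (s-injective : Injective _≡_ _≡_ s) (s≢p : ∀ i → s i ≢ p) where

  OffPath : Fin n → Set
  OffPath v = ∀ i → s i ≢ v

  data PathView (v : Fin n) : Set where
    onPath  : ∀ i → s i ≡ v → PathView v
    offPath : OffPath v → PathView v

  pathView : ∀ v → PathView v
  pathView v with FinP.any? (λ i → s i ≟ v)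
  ... | yes (i , si≡v) = onPath i si≡v
  ... | no ∄i          = offPath (λ i si≡v → ∄i (i , si≡v))

  -- Column s_i is e_p − e_{s_{r+1−i}}: for 0-based i, opposite i plays the role of r+1−i.
  B : Matrix n
  B l v with pathView v
  ... | onPath i _ = Id l p - Id l (s (opposite i))
  ... | offPath _  = Id l v

  B-onPath : ∀ i l → B l (s i) ≡ Id l p - Id l (s (opposite i))
  B-onPath i l with pathView (s i)
  ... | onPath i′ si′≡si rewrite s-injective si′≡si = refl
  ... | offPath off = ⊥-elim (off i refl)

  B-offPath : ∀ {v} → OffPath v → ∀ l → B l v ≡ Id l v
  B-offPath {v} off l with pathView v
  ... | onPath i si≡v = ⊥-elim (off i si≡v)
  ... | offPath _     = refl

  ∑-*B-onPath : ∀ (f : Fin n → ℤ) i → ∑ (λ l → f l * B l (s i)) ≡ f p - f (s (opposite i))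
  ∑-*B-onPath f i = begin
      ∑ (λ l → f l * B l (s i))
    ≡⟨ ∑-cong (λ l → trans (cong (f l *_) (B-onPath i l)) (distrib-- (f l) (Id l p) (Id l (s (opposite i))))) ⟩
      ∑ (λ l → f l * Id l p + - (f l * Id l (s (opposite i))))
    ≡⟨ ∑-distrib-+ (λ l → f l * Id l p) (λ l → - (f l * Id l (s (opposite i)))) ⟩
      ∑ (λ l → f l * Id l p) + ∑ (λ l → - (f l * Id l (s (opposite i))))
    ≡⟨ cong₂ _+_ (∑-*Id f p) (trans (∑-neg (λ l → f l * Id l (s (opposite i)))) (cong -_ (∑-*Id f (s (opposite i))))) ⟩
      f p - f (s (opposite i))
    ∎
    where
    open ≡-Reasoning
    distrib-- : ∀ c a b → c * (a - b) ≡ c * a + - (c * b)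
    distrib-- = solve-∀

  ∑-*B-offPath : ∀ (f : Fin n → ℤ) {v} → OffPath v → ∑ (λ l → f l * B l v) ≡ f v
  ∑-*B-offPath f {v} off = trans (∑-cong (λ l → cong (f l *_) (B-offPath off l))) (∑-*Id f v)

  B²≐Id : (B ⊗ B) ≐ Id
  B²≐Id l v = column v (pathView v)
    where
    column : ∀ v → PathView v → (B ⊗ B) l v ≡ Id l v
    column v (offPath off)   = trans (∑-*B-offPath (B l) off) (B-offPath off l)
    column _ (onPath i refl) = begin
        ∑ (λ k → B l k * B k (s i))
      ≡⟨ ∑-*B-onPath (B l) i ⟩
        B l p - B l (s (opposite i))
      ≡⟨ cong₂ _-_ (B-offPath s≢p l) (B-onPath (opposite i) l) ⟩
        Id l p - (Id l p - Id l (s (opposite (opposite i))))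
      ≡⟨ cancel (Id l p) (Id l (s (opposite (opposite i)))) ⟩
        Id l (s (opposite (opposite i)))
      ≡⟨ cong (Id l ∘ s) (FinP.opposite-involutive i) ⟩
        Id l (s i)
      ∎
      where
      open ≡-Reasoning
      cancel : ∀ a b → a - (a - b) ≡ b
      cancel = solve-∀

  det-B≡±1 : det B ≡ + 1 ⊎ det B ≡ - (+ 1)
  det-B≡±1 = *≡1⇒±1 (det B) (det B) (trans (sym (det-⊗ B B)) (trans (det-cong B²≐Id) (det-Id {n})))

  private
    congruence-column : ∀ (X : Matrix n) u v (G : Fin n → ℤ) → (∀ k → ∑ (λ l → X k l * B l v) ≡ G k) →
                        ((B ᵀ) ⊗ (X ⊗ B)) u v ≡ ∑ (λ k → G k * B k u)
    congruence-column X u v G XB≡G = ∑-cong (λ k → trans (cong (B k u *_) (XB≡G k)) (ℤP.*-comm (B k u) (G k)))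

  congruence-offOff : ∀ X {u v} → OffPath u → OffPath v → ((B ᵀ) ⊗ (X ⊗ B)) u v ≡ X u v
  congruence-offOff X {u} {v} u-off v-off =
    trans (congruence-column X u v (λ k → X k v) (λ k → ∑-*B-offPath (X k) v-off))
          (∑-*B-offPath (λ k → X k v) u-off)

  congruence-offOn : ∀ X {u} j → OffPath u →
                     ((B ᵀ) ⊗ (X ⊗ B)) u (s j) ≡ X u p - X u (s (opposite j))
  congruence-offOn X {u} j u-off =
    trans (congruence-column X u (s j) (λ k → X k p - X k (s (opposite j))) (λ k → ∑-*B-onPath (X k) j))
          (∑-*B-offPath (λ k → X k p - X k (s (opposite j))) u-off)

  congruence-onOff : ∀ X i {v} → OffPath v →
                     ((B ᵀ) ⊗ (X ⊗ B)) (s i) v ≡ X p v - X (s (opposite i)) v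
  congruence-onOff X i {v} v-off =
    trans (congruence-column X (s i) v (λ k → X k v) (λ k → ∑-*B-offPath (X k) v-off))
          (∑-*B-onPath (λ k → X k v) i)

  congruence-onOn : ∀ X i j → ((B ᵀ) ⊗ (X ⊗ B)) (s i) (s j) ≡
    (X p p - X p (s (opposite j))) - (X (s (opposite i)) p - X (s (opposite i)) (s (opposite j)))
  congruence-onOn X i j =
    trans (congruence-column X (s i) (s j) (λ k → X k p - X k (s (opposite j))) (λ k → ∑-*B-onPath (X k) j))
          (∑-*B-onPath (λ k → X k p - X k (s (opposite j))) i)

  record ReflectionEntries (A A′ : Matrix n) : Set where
    field
      offPath-agree : ∀ {x y} → OffPath x → OffPath y → A x y ≡ A′ x y
      toPath        : ∀ {x} i → OffPath x → A x (s i) ≡ A x p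
      toPath′       : ∀ {x} i → OffPath x → A′ x (s i) ≡ + 0
      fromPath      : ∀ i {y} → OffPath y → A (s i) y ≡ + 0
      fromPath′     : ∀ i {y} → OffPath y → A′ (s i) y ≡ A′ p y
      alongPath′    : ∀ i j → A′ (s (opposite i)) (s (opposite j)) ≡ A (s i) (s j)
      anchor′       : A′ p p ≡ + 1

  reflectionEntries⇒congruent : ∀ {A A′} → ReflectionEntries A A′ → A ≐ ((B ᵀ) ⊗ (A′ ⊗ B))
  reflectionEntries⇒congruent {A} {A′} E u v = sym (entry (pathView u) (pathView v))
    where
    open ReflectionEntries E
    entry : ∀ {u v} → PathView u → PathView v → ((B ᵀ) ⊗ (A′ ⊗ B)) u v ≡ A u v
    entry (offPath u-off) (offPath v-off) =
      trans (congruence-offOff A′ u-off v-off) (sym (offPath-agree u-off v-off))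
    entry {u} (offPath u-off) (onPath j refl) = begin
      ((B ᵀ) ⊗ (A′ ⊗ B)) u (s j)       ≡⟨ congruence-offOn A′ j u-off ⟩
      A′ u p - A′ u (s (opposite j))  ≡⟨ cong₂ _-_ (sym (offPath-agree u-off s≢p)) (toPath′ (opposite j) u-off) ⟩
      A u p - + 0                     ≡⟨ ℤP.+-identityʳ (A u p) ⟩
      A u p                           ≡⟨ toPath j u-off ⟨
      A u (s j)                       ∎
      where open ≡-Reasoning
    entry {v = v} (onPath i refl) (offPath v-off) = begin
      ((B ᵀ) ⊗ (A′ ⊗ B)) (s i) v       ≡⟨ congruence-onOff A′ i v-off ⟩
      A′ p v - A′ (s (opposite i)) v  ≡⟨ cong (_-_ (A′ p v)) (fromPath′ (opposite i) v-off) ⟩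
      A′ p v - A′ p v                 ≡⟨ ℤP.+-inverseʳ (A′ p v) ⟩
      + 0                             ≡⟨ fromPath i v-off ⟨
      A (s i) v                       ∎
      where open ≡-Reasoning
    entry (onPath i refl) (onPath j refl) = begin
        ((B ᵀ) ⊗ (A′ ⊗ B)) (s i) (s j)
      ≡⟨ congruence-onOn A′ i j ⟩
        (A′ p p - A′ p (s (opposite j))) - (A′ (s (opposite i)) p - A′ (s (opposite i)) (s (opposite j)))
      ≡⟨ cong₂ _-_ (cong₂ _-_ anchor′ (toPath′ (opposite j) s≢p))
                   (cong₂ _-_ (trans (fromPath′ (opposite i) s≢p) anchor′) (alongPath′ i j)) ⟩
        (+ 1 - + 0) - (+ 1 - A (s i) (s j))
      ≡⟨ cancel (A (s i) (s j)) ⟩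
        A (s i) (s j)
      ∎
      where
      open ≡-Reasoning
      cancel : ∀ a → (+ 1 - + 0) - (+ 1 - a) ≡ a
      cancel = solve-∀

incidence-cong : ∀ {n} {R R′ : Fin n → Fin n → Set} {M M′ : Matrix n} →
  IsIncidenceOf R M → IsIncidenceOf R′ M′ →
  ∀ {a b c d} → (R a b → R′ c d) → (R′ c d → R a b) → Dec (R a b) → M a b ≡ M′ c d
incidence-cong M-inc M′-inc {a} {b} {c} {d} to from (yes ab) =
  trans (proj₁ (M-inc a b) ab) (sym (proj₁ (M′-inc c d) (to ab)))
incidence-cong M-inc M′-inc {a} {b} {c} {d} to from (no ¬ab) =
  trans (proj₂ (M-inc a b) ¬ab) (sym (proj₂ (M′-inc c d) (¬ab ∘ from)))

opposite-≤ : ∀ {r} {i j : Fin r} → toℕ i ℕ.≤ toℕ j → toℕ (opposite j) ℕ.≤ toℕ (opposite i)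
opposite-≤ {r} {i} {j} i≤j =
  subst₂ ℕ._≤_ (sym (FinP.opposite-prop j)) (sym (FinP.opposite-prop i)) (ℕP.∸-monoʳ-≤ r (s≤s i≤j))

opposite-≤⁻¹ : ∀ {r} {i j : Fin r} → toℕ (opposite j) ℕ.≤ toℕ (opposite i) → toℕ i ℕ.≤ toℕ j
opposite-≤⁻¹ {i = i} {j} le =
  subst₂ (λ a b → toℕ a ℕ.≤ toℕ b) (FinP.opposite-involutive i) (FinP.opposite-involutive j) (opposite-≤ le)

-- Walks through an anchored path

module AnchoredWalks {n r : ℕ} (E : Fin n → Fin n → Set) (p : Fin n) (s : Fin r → Fin n)
                     (s-injective : Injective _≡_ _≡_ s) (s≢p : ∀ i → s i ≢ p) where

  open PathReflection p s s-injective s≢p using (OffPath)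

  -- Pred, Succ and OnJp are definitionally PathPred J p s, PathSucc J p s and
  -- InJp J p s, and for E = FinPoset.Cov J, Reflected is ReflEdge J p s.
  Pred : Fin r → Fin n → Set
  Pred i v = (toℕ i ≡ 0 × v ≡ p) ⊎ (Σ[ k ∈ Fin r ] (suc (toℕ k) ≡ toℕ i × v ≡ s k))

  Succ : Fin r → Fin n → Set
  Succ i v = Σ[ k ∈ Fin r ] (toℕ k ≡ suc (toℕ i) × v ≡ s k)

  OnJp : Fin n → Set
  OnJp v = v ≡ p ⊎ ∃ (λ i → s i ≡ v)

  Reflected : Fin n → Fin n → Set
  Reflected a b = (E a b × ¬ (OnJp a × OnJp b)) ⊎ (E b a × OnJp a × OnJp b)

  onPath? : ∀ v → Dec (∃ λ i → s i ≡ v)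
  onPath? v = FinP.any? (λ i → s i ≟ v)

  onJp? : ∀ v → Dec (OnJp v)
  onJp? v with v ≟ p | onPath? v
  ... | yes v≡p | _         = yes (inj₁ v≡p)
  ... | no _    | yes on    = yes (inj₂ on)
  ... | no v≢p  | no off    = no λ { (inj₁ v≡p) → v≢p v≡p ; (inj₂ on) → off on }

  offPath-onJp⇒anchor : ∀ {v} → OffPath v → OnJp v → v ≡ p
  offPath-onJp⇒anchor _   (inj₁ v≡p)       = v≡p
  offPath-onJp⇒anchor off (inj₂ (i , si≡v)) = ⊥-elim (off i si≡v)

  reachesAlong : (R : Fin n → Fin n → Set) → (∀ a b → toℕ b ≡ suc (toℕ a) → R (s a) (s b)) →
                 ∀ i j → toℕ i ℕ.≤ toℕ j → Star R (s i) (s j)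
  reachesAlong R step i j i≤j = go (toℕ j ℕ.∸ toℕ i) j (sym (ℕP.m∸n+n≡m i≤j))
    where
    go : ∀ d j → toℕ j ≡ d ℕ.+ toℕ i → Star R (s i) (s j)
    go zero    j j≡i = subst (λ z → Star R (s i) (s z)) (FinP.toℕ-injective (sym j≡i)) ε
    go (suc d) j j≡d+i = go d j′ (FinP.toℕ-fromℕ< j′<r) ◅◅ (step j′ j (trans j≡d+i (cong suc (sym (FinP.toℕ-fromℕ< j′<r)))) ◅ ε)
      where
      j′<r : d ℕ.+ toℕ i ℕ.< r
      j′<r = ℕP.<-trans (ℕP.n<1+n _) (subst (ℕ._< r) j≡d+i (FinP.toℕ<n j))
      j′ = fromℕ< j′<r

  module OutwardShaped (into     : ∀ i v → E v (s i) → Pred i v)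
                       (fromPred : ∀ i v → Pred i v → E v (s i))
                       (outOf    : ∀ i v → E (s i) v → Succ i v) where

    step : ∀ a b → toℕ b ≡ suc (toℕ a) → E (s a) (s b)
    step a b b≡a+1 = fromPred b (s a) (inj₂ (a , sym b≡a+1 , refl))

    stepBack′ : ∀ a b → toℕ b ≡ suc (toℕ a) → Reflected (s b) (s a)
    stepBack′ a b b≡a+1 = inj₂ (step a b b≡a+1 , inj₂ (b , refl) , inj₂ (a , refl))

    first : ∀ (i : Fin r) → Fin r
    first i = fromℕ< (ℕP.≤-<-trans z≤n (FinP.toℕ<n i))

    first-pred : ∀ i → Pred (first i) p
    first-pred i = inj₁ (FinP.toℕ-fromℕ< _ , refl)

    first≤ : ∀ i → toℕ (first i) ℕ.≤ toℕ i
    first≤ i = subst (ℕ._≤ toℕ i) (sym (FinP.toℕ-fromℕ< _)) z≤n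

    anchor-reaches-path : ∀ i → Star E p (s i)
    anchor-reaches-path i = fromPred (first i) p (first-pred i) ◅ reachesAlong E step (first i) i (first≤ i)

    path-reaches′-anchor : ∀ i → Star Reflected (s i) p
    path-reaches′-anchor i =
      reverse id (reachesAlong (λ a b → Reflected b a) stepBack′ (first i) i (first≤ i))
      ◅◅ (inj₂ (fromPred (first i) p (first-pred i) , inj₂ (first i , refl) , inj₁ refl) ◅ ε)

    offPath-enters-at-anchor : ∀ {w k} → OffPath w → E w (s k) → w ≡ p
    offPath-enters-at-anchor {w} {k} off e with into k w e
    ... | inj₁ (_ , w≡p)      = w≡p
    ... | inj₂ (k′ , _ , w≡sk′) = ⊥-elim (off k′ (sym w≡sk′))

    offPath-reaches-path⇒anchor : ∀ {x y} → Star E x y → OffPath x → (∃ λ i → s i ≡ y) → Star E x p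
    offPath-reaches-path⇒anchor ε off (i , si≡x) = ⊥-elim (off i si≡x)
    offPath-reaches-path⇒anchor {x} (_◅_ {j = w} e rest) off on with onPath? w
    ... | yes (k , sk≡w) = subst (λ z → Star E z p) (sym (offPath-enters-at-anchor off (subst (E x) (sym sk≡w) e))) ε
    ... | no w-off       = e ◅ offPath-reaches-path⇒anchor rest (λ i si≡w → w-off (i , si≡w)) on

    path-notReaches-offPath : ∀ {a y} → Star E a y → (∃ λ i → s i ≡ a) → OffPath y → ⊥
    path-notReaches-offPath ε (i , si≡a) off = off i si≡a
    path-notReaches-offPath (e ◅ rest) (i , refl) off with outOf i _ e
    ... | k , _ , refl = path-notReaches-offPath rest (k , refl) off

    reachesAlong⇒≤ : ∀ {a b} → Star E a b → ∀ i j → s i ≡ a → s j ≡ b → toℕ i ℕ.≤ toℕ j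
    reachesAlong⇒≤ ε i j si≡a sj≡a = ℕP.≤-reflexive (cong toℕ (s-injective (trans si≡a (sym sj≡a))))
    reachesAlong⇒≤ (e ◅ rest) i j refl sj≡b with outOf i _ e
    ... | k , k≡i+1 , refl = ℕP.≤-trans (ℕP.n≤1+n (toℕ i)) (subst (ℕ._≤ toℕ j) k≡i+1 (reachesAlong⇒≤ rest k j refl sj≡b))

    offPath-arrow⇒arrow′ : ∀ {a b} → OffPath a → OffPath b → E a b → Reflected a b
    offPath-arrow⇒arrow′ {a} {b} a-off b-off e with onJp? a | onJp? b
    ... | yes a∈ | yes b∈ = inj₂ (subst₂ E (trans a≡p (sym b≡p)) (trans b≡p (sym a≡p)) e , a∈ , b∈)
      where
      a≡p = offPath-onJp⇒anchor a-off a∈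
      b≡p = offPath-onJp⇒anchor b-off b∈
    ... | yes _  | no b∉  = inj₁ (e , b∉ ∘ proj₂)
    ... | no a∉  | _      = inj₁ (e , a∉ ∘ proj₁)

    offPath-arrow′⇒arrow : ∀ {a b} → OffPath a → OffPath b → Reflected a b → E a b
    offPath-arrow′⇒arrow a-off b-off (inj₁ (e , _)) = e
    offPath-arrow′⇒arrow a-off b-off (inj₂ (e , a∈ , b∈)) =
      subst₂ E (trans b≡p (sym a≡p)) (trans a≡p (sym b≡p)) e
      where
      a≡p = offPath-onJp⇒anchor a-off a∈
      b≡p = offPath-onJp⇒anchor b-off b∈

    offPath-arrow′-stays : ∀ {x w} → OffPath x → Reflected x w → OffPath w
    offPath-arrow′-stays off (inj₁ (e , not-both)) k refl =
      not-both (inj₁ (offPath-enters-at-anchor off e) , inj₂ (k , refl))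
    offPath-arrow′-stays off (inj₂ (e , _)) k refl with outOf k _ e
    ... | k′ , _ , x≡sk′ = off k′ (sym x≡sk′)

    offPath-reaches′⇒reaches : ∀ {x y} → Star Reflected x y → OffPath x → OffPath y × Star E x y
    offPath-reaches′⇒reaches ε off = off , ε
    offPath-reaches′⇒reaches (e ◅ rest) off =
      let w-off = offPath-arrow′-stays off e
          y-off , path = offPath-reaches′⇒reaches rest w-off
      in y-off , offPath-arrow′⇒arrow off w-off e ◅ path

    -- Such a walk cannot visit the path, since it could never leave it again.
    offPath-reaches⇒reaches′ : ∀ {x y} → Star E x y → OffPath x → OffPath y → Star Reflected x y
    offPath-reaches⇒reaches′ ε _ _ = ε
    offPath-reaches⇒reaches′ (_◅_ {j = w} e rest) x-off y-off with onPath? w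
    ... | yes (k , refl) = ⊥-elim (path-notReaches-offPath rest (k , refl) y-off)
    ... | no w∉ = offPath-arrow⇒arrow′ x-off w-off e ◅ offPath-reaches⇒reaches′ rest w-off y-off
      where
      w-off : OffPath w
      w-off i si≡w = w∉ (i , si≡w)

    path-arrow′⇒pred : ∀ {i w} → Reflected (s i) w → Pred i w
    path-arrow′⇒pred {i} (inj₁ (e , not-both)) with outOf i _ e
    ... | k , _ , refl = ⊥-elim (not-both (inj₂ (i , refl) , inj₂ (k , refl)))
    path-arrow′⇒pred {i} (inj₂ (e , _)) = into i _ e

    path-reaches′⇒anchor-reaches′ : ∀ {a y} → Star Reflected a y → (∃ λ i → s i ≡ a) → OffPath y →
                                    Star Reflected p y
    path-reaches′⇒anchor-reaches′ ε (i , si≡a) off = ⊥-elim (off i si≡a)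
    path-reaches′⇒anchor-reaches′ (e ◅ rest) (i , refl) off with path-arrow′⇒pred e
    ... | inj₁ (_ , refl)     = rest
    ... | inj₂ (k , _ , refl) = path-reaches′⇒anchor-reaches′ rest (k , refl) off

    reachesAlong′⇒≥ : ∀ {a b} → Star Reflected a b → ∀ i j → s i ≡ a → s j ≡ b → toℕ j ℕ.≤ toℕ i
    reachesAlong′⇒≥ ε i j si≡a sj≡a = ℕP.≤-reflexive (cong toℕ (s-injective (trans sj≡a (sym si≡a))))
    reachesAlong′⇒≥ (e ◅ rest) i j refl sj≡b with path-arrow′⇒pred e
    ... | inj₁ (_ , refl) = ⊥-elim (proj₁ (offPath-reaches′⇒reaches rest s≢p) j sj≡b)
    ... | inj₂ (k , k+1≡i , refl) =
      ℕP.≤-trans (reachesAlong′⇒≥ rest k j refl sj≡b) (subst (toℕ k ℕ.≤_) k+1≡i (ℕP.n≤1+n (toℕ k)))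

    reflectionEntries : ∀ {A A′} → IsIncidenceOf (Star E) A → IsIncidenceOf (Star Reflected) A′ →
      (∀ {x y} → OffPath x → OffPath y → Dec (Star E x y)) →
      PathReflection.ReflectionEntries p s s-injective s≢p A A′
    reflectionEntries {A} {A′} A-inc A′-inc reaches? = record
      { offPath-agree = λ x-off y-off →
          incidence-cong A-inc A′-inc (λ st → offPath-reaches⇒reaches′ st x-off y-off)
                                      (λ st → proj₂ (offPath-reaches′⇒reaches st x-off)) (reaches? x-off y-off)
      ; toPath = λ i x-off → sym (incidence-cong A-inc A-inc (_◅◅ anchor-reaches-path i)
                                   (λ st → offPath-reaches-path⇒anchor st x-off (i , refl)) (reaches? x-off s≢p))
      ; toPath′ = λ {x} i x-off → proj₂ (A′-inc x (s i)) (λ st → proj₁ (offPath-reaches′⇒reaches st x-off) i refl)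
      ; fromPath = λ i {y} y-off → proj₂ (A-inc (s i) y) (λ st → path-notReaches-offPath st (i , refl) y-off)
      ; fromPath′ = λ i y-off → sym (incidence-cong A′-inc A′-inc (path-reaches′-anchor i ◅◅_)
                                      (λ st → path-reaches′⇒anchor-reaches′ st (i , refl) y-off)
                                      (map′ (λ st → offPath-reaches⇒reaches′ st s≢p y-off)
                                            (λ st → proj₂ (offPath-reaches′⇒reaches st s≢p)) (reaches? s≢p y-off)))
      ; alongPath′ = λ i j → incidence-cong A′-inc A-inc
          (λ st → reachesAlong E step i j (opposite-≤⁻¹ (reachesAlong′⇒≥ st (opposite i) (opposite j) refl refl)))
          (λ st → reverse id (reachesAlong (λ a b → Reflected b a) stepBack′ (opposite j) (opposite i)
                                (opposite-≤ (reachesAlong⇒≤ st i j refl refl))))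
          (map′ (λ le → reverse id (reachesAlong (λ a b → Reflected b a) stepBack′ (opposite j) (opposite i) le))
                (λ st → reachesAlong′⇒≥ st (opposite i) (opposite j) refl refl)
                (toℕ (opposite j) ℕ.≤? toℕ (opposite i)))
      ; anchor′ = proj₁ (A′-inc p p) ε
      }

-- Hasse digraphs

count : ∀ {n} {P : Fin n → Set} → (∀ i → Dec (P i)) → ℕ
count {zero}  P? = 0
count {suc n} P? with P? zero
... | yes _ = suc (count (P? ∘ suc))
... | no _  = count (P? ∘ suc)

count-mono : ∀ {n} {P Q : Fin n → Set} (P? : ∀ i → Dec (P i)) (Q? : ∀ i → Dec (Q i)) →
             (∀ i → P i → Q i) → count P? ℕ.≤ count Q?
count-mono {zero}  P? Q? P⇒Q = z≤n
count-mono {suc n} P? Q? P⇒Q with P? zero | Q? zero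
... | yes _  | yes _  = s≤s (count-mono (P? ∘ suc) (Q? ∘ suc) (P⇒Q ∘ suc))
... | yes p0 | no ¬q0 = ⊥-elim (¬q0 (P⇒Q zero p0))
... | no _   | yes _  = ℕP.m≤n⇒m≤1+n (count-mono (P? ∘ suc) (Q? ∘ suc) (P⇒Q ∘ suc))
... | no _   | no _   = count-mono (P? ∘ suc) (Q? ∘ suc) (P⇒Q ∘ suc)

count-strict : ∀ {n} {P Q : Fin n → Set} (P? : ∀ i → Dec (P i)) (Q? : ∀ i → Dec (Q i)) →
               (∀ i → P i → Q i) → ∀ a → Q a → ¬ P a → count P? ℕ.< count Q?
count-strict {suc n} P? Q? P⇒Q a qa ¬pa with P? zero | Q? zero | a
... | yes p0 | _      | zero  = ⊥-elim (¬pa p0)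
... | no _   | yes _  | zero  = s≤s (count-mono (P? ∘ suc) (Q? ∘ suc) (P⇒Q ∘ suc))
... | no _   | no ¬q0 | zero  = ⊥-elim (¬q0 qa)
... | yes _  | yes _  | suc a = s≤s (count-strict (P? ∘ suc) (Q? ∘ suc) (P⇒Q ∘ suc) a qa ¬pa)
... | yes p0 | no ¬q0 | suc a = ⊥-elim (¬q0 (P⇒Q zero p0))
... | no _   | yes _  | suc a = ℕP.m≤n⇒m≤1+n (count-strict (P? ∘ suc) (Q? ∘ suc) (P⇒Q ∘ suc) a qa ¬pa)
... | no _   | no _   | suc a = count-strict (P? ∘ suc) (Q? ∘ suc) (P⇒Q ∘ suc) a qa ¬pa

module Hasse {n} (J : FinPoset n) where
  open FinPoset J
  private module ≼ = IsPartialOrder isPartialOrder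

  _≺?_ : ∀ a b → Dec (a ≺ b)
  a ≺? b = (a ≼? b) ×-dec ¬? (a ≟ b)

  intervalSize : Fin n → Fin n → ℕ
  intervalSize x y = count (λ z → (x ≺? z) ×-dec (z ≼? y))

  -- An element strictly between x and y splits (x, y] into two strictly smaller intervals.
  ≼⇒Cov* : ∀ {x y} → x ≼ y → Star Cov x y
  ≼⇒Cov* {x} {y} = go (suc (intervalSize x y)) x y (ℕP.n<1+n _)
    where
    go : ∀ k x y → intervalSize x y ℕ.< k → x ≼ y → Star Cov x y
    go (suc k) x y size<k x≼y with x ≟ y
    ... | yes refl = ε
    ... | no x≢y with FinP.any? (λ z → (x ≺? z) ×-dec (z ≺? y))
    ...   | no ∄z = ((x≼y , x≢y) , λ z between → ∄z (z , between)) ◅ ε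
    ...   | yes (z , (x≼z , x≢z) , (z≼y , z≢y)) = go k x z lower x≼z ◅◅ go k z y upper z≼y
      where
      lower : intervalSize x z ℕ.< k
      lower = ℕP.<-≤-trans
        (count-strict _ _ (λ w (x≺w , w≼z) → x≺w , ≼.trans w≼z z≼y) y ((x≼y , x≢y) , ≼.refl)
                      (λ (_ , y≼z) → z≢y (≼.antisym z≼y y≼z)))
        (ℕ.s≤s⁻¹ size<k)
      upper : intervalSize z y ℕ.< k
      upper = ℕP.<-≤-trans
        (count-strict _ _ (λ w ((z≼w , z≢w) , w≼y) →
                              (≼.trans x≼z z≼w , λ x≡w → z≢w (≼.antisym z≼w (subst (_≼ z) x≡w x≼z))) , w≼y)
                      z ((x≼z , x≢z) , z≼y) (λ ((_ , z≢z) , _) → z≢z refl))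
        (ℕ.s≤s⁻¹ size<k)

  Cov*⇒≼ : ∀ {x y} → Star Cov x y → x ≼ y
  Cov*⇒≼ = Star.fold _≼_ (λ ((x≼y , _) , _) y≼z → ≼.trans x≼y y≼z) ≼.refl

  Cov-asym : ∀ {a b} → Cov a b → ¬ Cov b a
  Cov-asym ((a≼b , a≢b) , _) ((b≼a , _) , _) = a≢b (≼.antisym a≼b b≼a)

  incidence-Cov* : IsIncidenceOf (Star Cov) (incidence J)
  incidence-Cov* i j with i ≼? j
  ... | yes i≼j = (λ _ → refl) , (λ ¬path → ⊥-elim (¬path (≼⇒Cov* i≼j)))
  ... | no i⋠j  = (λ path → ⊥-elim (i⋠j (Cov*⇒≼ path))) , (λ _ → refl)

-- Reflecting an anchored path of a poset

module AnchoredPathReflection {n} (J : FinPoset n) (p : Fin n) {r} (s : Fin r → Fin n)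
                              (anchored : AnchoredPath J p s) where
  open FinPoset J
  open AnchoredPath anchored
  open Hasse J
  open PathReflection p s distinct notAnchor public

  neighbour : ∀ i v → Adj v (s i) → PathPred J p s i v ⊎ PathSucc J p s i v
  neighbour i v = proj₁ (neighbours i v)

  module OfOutward (outward : Outward J p s) where
    open AnchoredWalks Cov p s distinct notAnchor

    into : ∀ i v → Cov v (s i) → Pred i v
    into i v c with neighbour i v (inj₁ c)
    ... | inj₁ pred                 = pred
    ... | inj₂ (k , k≡i+1 , refl)   = ⊥-elim (Cov-asym c (outward k (s i) (inj₂ (i , sym k≡i+1 , refl))))

    outOf : ∀ i v → Cov (s i) v → Succ i v
    outOf i v c with neighbour i v (inj₂ c)
    ... | inj₁ pred = ⊥-elim (Cov-asym c (outward i v pred))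
    ... | inj₂ succ = succ

    open OutwardShaped into outward outOf

    entries : ∀ {Cδ} → IsIncidenceOf (_≼δ_ J p s) Cδ → ReflectionEntries (incidence J) Cδ
    entries Cδ-inc = reflectionEntries incidence-Cov* Cδ-inc (λ {x} {y} _ _ → map′ ≼⇒Cov* Cov*⇒≼ (x ≼? y))

  module OfInward (inward : Inward J p s) where
    open AnchoredWalks (ReflEdge J p s) p s distinct notAnchor

    neighbour-onJp : ∀ {i v} → PathPred J p s i v ⊎ PathSucc J p s i v → OnJp v
    neighbour-onJp (inj₁ (inj₁ (_ , v≡p)))     = inj₁ v≡p
    neighbour-onJp (inj₁ (inj₂ (k , _ , v≡sk))) = inj₂ (k , sym v≡sk)
    neighbour-onJp (inj₂ (k , _ , v≡sk))        = inj₂ (k , sym v≡sk)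

    into : ∀ i v → ReflEdge J p s v (s i) → Pred i v
    into i v (inj₁ (c , not-both)) = ⊥-elim (not-both (neighbour-onJp (neighbour i v (inj₁ c)) , inj₂ (i , refl)))
    into i v (inj₂ (c , _)) with neighbour i v (inj₂ c)
    ... | inj₁ pred               = pred
    ... | inj₂ (k , k≡i+1 , refl) = ⊥-elim (Cov-asym c (inward k (s i) (inj₂ (i , sym k≡i+1 , refl))))

    fromPred : ∀ i v → Pred i v → ReflEdge J p s v (s i)
    fromPred i v pred = inj₂ (inward i v pred , neighbour-onJp {i} (inj₁ pred) , inj₂ (i , refl))

    outOf : ∀ i v → ReflEdge J p s (s i) v → Succ i v
    outOf i v (inj₁ (c , not-both)) = ⊥-elim (not-both (inj₂ (i , refl) , neighbour-onJp (neighbour i v (inj₂ c))))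
    outOf i v (inj₂ (c , _)) with neighbour i v (inj₁ c)
    ... | inj₁ pred = ⊥-elim (Cov-asym c (inward i v pred))
    ... | inj₂ succ = succ

    open OutwardShaped into fromPred outOf

    Reflected⇒Cov : ∀ {a b} → Reflected a b → Cov a b
    Reflected⇒Cov (inj₁ (inj₁ (c , _) , _))             = c
    Reflected⇒Cov (inj₁ (inj₂ (_ , a∈ , b∈) , not-both)) = ⊥-elim (not-both (a∈ , b∈))
    Reflected⇒Cov (inj₂ (inj₁ (_ , not-both) , a∈ , b∈)) = ⊥-elim (not-both (b∈ , a∈))
    Reflected⇒Cov (inj₂ (inj₂ (c , _) , _))             = c

    Cov⇒Reflected : ∀ {a b} → Cov a b → Reflected a b
    Cov⇒Reflected {a} {b} c with onJp? a | onJp? b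
    ... | yes a∈ | yes b∈ = inj₂ (inj₂ (c , b∈ , a∈) , a∈ , b∈)
    ... | yes _  | no b∉  = inj₁ (inj₁ (c , b∉ ∘ proj₂) , b∉ ∘ proj₂)
    ... | no a∉  | _      = inj₁ (inj₁ (c , a∉ ∘ proj₁) , a∉ ∘ proj₁)

    incidence-Reflected* : IsIncidenceOf (Star Reflected) (incidence J)
    incidence-Reflected* i j =
      (λ path → proj₁ (incidence-Cov* i j) (Star.map Reflected⇒Cov path)) ,
      (λ ¬path → proj₂ (incidence-Cov* i j) (¬path ∘ Star.map Cov⇒Reflected))

    entries : ∀ {Cδ} → IsIncidenceOf (_≼δ_ J p s) Cδ → ReflectionEntries Cδ (incidence J)
    entries Cδ-inc = reflectionEntries Cδ-inc incidence-Reflected* λ {x} {y} x-off y-off →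
      map′ (λ x≼y → proj₂ (offPath-reaches′⇒reaches (Star.map Cov⇒Reflected (≼⇒Cov* x≼y)) x-off))
           (λ path → Cov*⇒≼ (Star.map Reflected⇒Cov (offPath-reaches⇒reaches′ path x-off y-off)))
           (x ≼? y)

lemma3p3 : ∀ {n : ℕ} (J : FinPoset n) (p : Fin n) (r : ℕ) (s : Fin r → Fin n) →
    1 ≤ r → AnchoredPath J p s → Inward J p s ⊎ Outward J p s →
    (Cδ : Matrix n) → IsIncidenceOf (_≼δ_ J p s) Cδ →
    (Σ[ B ∈ Matrix n ] ((det B ≡ + 1 ⊎ det B ≡ - (+ 1))
        × incidence J ≐ ((B ᵀ) ⊗ (Cδ ⊗ B))))
    × (∀ (r' : ℕ) → NonNegCorank (incidence J) r' ⇔ NonNegCorank Cδ r')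
lemma3p3 J p r s _ anchored direction Cδ Cδ-inc =
  (B , det-B≡±1 , C≐BᵀCδB) ,
  λ r′ → mk⇔ (NonNegCorank-congruence B Cδ (incidence J) Cδ≐BᵀCB C≐BᵀCδB r′)
             (NonNegCorank-congruence B (incidence J) Cδ C≐BᵀCδB Cδ≐BᵀCB r′)
  where
  open AnchoredPathReflection J p s anchored
  congruent : Inward J p s ⊎ Outward J p s → incidence J ≐ ((B ᵀ) ⊗ (Cδ ⊗ B))
  congruent (inj₁ inward)  = congruence-involutive B Cδ (incidence J) B²≐Id
                               (reflectionEntries⇒congruent (OfInward.entries inward Cδ-inc))
  congruent (inj₂ outward) = reflectionEntries⇒congruent (OfOutward.entries outward Cδ-inc)
  C≐BᵀCδB : incidence J ≐ ((B ᵀ) ⊗ (Cδ ⊗ B))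
  C≐BᵀCδB = congruent direction
  Cδ≐BᵀCB : Cδ ≐ ((B ᵀ) ⊗ (incidence J ⊗ B))
  Cδ≐BᵀCB = congruence-involutive B (incidence J) Cδ B²≐Id C≐BᵀCδB
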